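{- Let $P$ be a tableau of shape $\beta/\alpha$ with entries from $[k]$ and $Q$ a tableau of shape $\delta/\beta$ with entries from $[k']$ (so $Q$ extends $P$), and let $l$ be at least the initial part of $\delta$. Let $Q^C$ be the complement of $Q$ with respect to $k',l$; after the vertical shift $P\mapsto(l^{k'},P)$, the tableaux $P$ and $Q^C$ share the outer border $(l^{k'},\beta)$. Let $(T',U')=\mathcal{R}(P,Q^C)$ be the result of internal row insertion (with parameter $l$), and let $\mathcal{J}(P,Q)=(T,U)$ be the result of the jeu de taquin. Then, identifying tableaux that differ by a vertical shift, $T=T'$ and $U=(U')^C$ (complement with respect to $k',l$). That is, the complement $\mathcal{R}^C$ of internal row insertion coincides with the jeu de taquin $\mathcal{J}$.
   Context: Partitions are weakly decreasing sequences of nonnegative integers indexed by intervals of integers, ordered componentwise; $\beta/\alpha$ is a horizontal strip if $\beta_i\geq\alpha_i\geq\beta_{i+1}$ for all $i$. A tableau of shape $\beta/\alpha$ with entries from $[k]$ is a chain $\alpha=\beta^0\subseteq\cdots\subseteq\beta^k=\beta$ with horizontal-strip differences (the boxes of $\beta^i/\beta^{i-1}$ hold $i$); tableaux differing by a vertical shift are identified; $(l^i,\gamma)$ denotes $\gamma$ with $i$ parts $l$ prepended, and $(l^i,P)$ applies this to every shape of $P$. Complement of $T:\beta^0\subseteq\cdots\subseteq\beta^k$ w.r.t. $k,l$: $T^C:\beta^k\subseteq(l,\beta^{k-1})\subseteq\cdots\subseteq(l^k,\beta^0)$. Growth diagram: rectangular array of partitions whose rows (left to right) and columns (top to bottom)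 are tableaux, all rows of equal content and all columns of equal content. Local rule $\mathcal{R}$: for $\alpha,\beta,\gamma$ with $\beta/\alpha,\gamma/\alpha$ horizontal strips, all with initial ($m$th) part equal to $l$ (prepend $l$ if necessary), $\delta=\mathcal{R}(\alpha;\beta,\gamma)$ has $\delta_m=l$ and $\delta_i=\max\{\beta_i,\gamma_i\}+\min\{\beta_{i-1},\gamma_{i-1}\}-\alpha_{i-1}$ for $i>m$; conversely, given $\beta,\gamma,\delta$ (with initial parts $l$) there is a unique $\alpha$ with $\mathcal{R}(\alpha;\beta,\gamma)=\delta$. Internal row insertion: for tableaux $P,Q$ sharing an outer border, write $P$ across the last row and $Q$ down the last column of a rectangular array and complete it to a growth diagram by repeatedly determining the upper-left corner $\alpha$ of a $2\times 2$ square from $\beta$ (upper right), $\gamma$ (lower left), $\delta$ (lower right) via $\mathcal{R}$; then $\mathcal{R}(P,Q)=(T,U)$ with $T$ the first row and $U$ the first column (for $P,Q$ sharing an inner border one writes them across the first row and down the first column and takes the last row and last column). Jeu de taquin $\mathcal{J}$: a jeu de taquin slide into an inner corner moves the empty box, interchanging it repeatedly with its right or lower neighbour (the smaller one, the lower one if equal) keeping rows weakly and columns strictly increasing, until it reaches an outer corner. The standard renumbering of $P$ numbers the boxes of each horizontal strip $\beta^i/\beta^{i-1}$ from left to right, strips in increasing order of $i$. For $Q$ extending $P$, perform slides on $Q$ successively into the boxes of $P$ in decreasing order of standard renumbering; $U$ is the resulting tableau (with inner border $\alpha$) and $T$ is the tableau with outer border $\delta$ whose boxes are the outer corners vacated,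 the box vacated by the slide into a box of $P$ receiving that box's entry in $P$. Then $\mathcal{J}(P,Q)=(T,U)$. -}

module Defs where

open import Data.Nat using (ℕ; zero; suc; _+_; _∸_; _≤_; _⊔_; _⊓_; _≤ᵇ_; _<ᵇ_; _≡ᵇ_)
open import Data.Bool using (Bool; true; false; if_then_else_; _∧_)
open import Data.Fin using (Fin; toℕ; fromℕ; inject₁; opposite) renaming (zero to fzero; suc to fsuc)
open import Data.Nat.ListAction using (sum)
open import Data.List using (List; []; _∷_; _++_; replicate; length; filterᵇ; concatMap; map; upTo; downFrom; allFin; reverse; foldl; concat)
open import Data.Product using (_×_; _,_; Σ; ∃; proj₁; proj₂)
open import Data.Sum using (_⊎_)
open import Relation.Binary.PropositionalEquality using (_≡_)

-- A partition is a finite list of parts, top (initial) part first.  It is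
-- read as padded with zeros below, so lists differing by trailing zeros
-- denote the same partition (see _≐_).  All partitions of one tableau /
-- growth diagram are aligned at their top row; (l^i , γ) prepends i rows l.

Partition : Set
Partition = List ℕ

part : Partition → ℕ → ℕ
part []       _       = 0
part (x ∷ _)  zero    = x
part (_ ∷ xs) (suc i) = part xs i

IsPartition : Partition → Set
IsPartition γ = ∀ i → part γ (suc i) ≤ part γ i

_≐_ : Partition → Partition → Set
α ≐ β = ∀ i → part α i ≡ part β i

HStrip : Partition → Partition → Set
HStrip α β = ∀ i → (part α i ≤ part β i) × (part β (suc i) ≤ part α i)

prepend : ℕ → ℕ → Partition → Partition
prepend i l γ = replicate i l ++ γ

size : Partition → ℕ
size = sum

-- Tableaux with entries from [k] : chains  β^0 ⊆ β^1 ⊆ ... ⊆ β^k .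

Chain : ℕ → Set
Chain k = Fin (suc k) → Partition

innerB : ∀ {k} → Chain k → Partition
innerB T = T fzero

outerB : ∀ {k} → Chain k → Partition
outerB {k} T = T (fromℕ k)

IsTableau : ∀ {k} → Chain k → Set
IsTableau {k} T = (∀ j → IsPartition (T j)) × (∀ (j : Fin k) → HStrip (T (inject₁ j)) (T (fsuc j)))

_≈T_ : ∀ {k} → Chain k → Chain k → Set
S ≈T T = ∀ j → S j ≐ T j

shiftT : ∀ {k} → ℕ → ℕ → Chain k → Chain k
shiftT i l T j = prepend i l (T j)

ShiftEq : ∀ {k} → Chain k → Chain k → Set
ShiftEq S T = (Σ ℕ λ c → Σ ℕ λ i → S ≈T shiftT i c T)
            ⊎ (Σ ℕ λ c → Σ ℕ λ i → T ≈T shiftT i c S)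

complement : ∀ k → ℕ → Chain k → Chain k
complement k l T j = prepend (toℕ j) l (T (opposite j))

content : ∀ {k} → Chain k → Fin k → ℕ
content T j = size (T (fsuc j)) ∸ size (T (inject₁ j))

-- Local rule R (parameter l).  All four shapes get an initial part l
-- prepended; then δ_m = l and
-- δ_i = max{β_i,γ_i} + min{β_{i-1},γ_{i-1}} - α_{i-1}   (i > m).

ruleR : ℕ → Partition → Partition → Partition → ℕ → ℕ
ruleR l α β γ zero    = l
ruleR l α β γ (suc i) =
  (part (l ∷ β) (suc i) ⊔ part (l ∷ γ) (suc i))
  + (part (l ∷ β) i ⊓ part (l ∷ γ) i) ∸ part (l ∷ α) i

LocalRule : ℕ → Partition → Partition → Partition → Partition → Set
LocalRule l α β γ δ = ∀ i → part (l ∷ δ) i ≡ ruleR l α β γ i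

-- Growth diagrams: (m+1) × (n+1) arrays G i j (i = row, top to bottom;
-- j = column, left to right).

Array : ℕ → ℕ → Set
Array m n = Fin (suc m) → Fin (suc n) → Partition

rowOf : ∀ {m n} → Array m n → Fin (suc m) → Chain n
rowOf G i j = G i j

colOf : ∀ {m n} → Array m n → Fin (suc n) → Chain m
colOf G j i = G i j

IsGrowthDiagram : ∀ {m n} → ℕ → Array m n → Set
IsGrowthDiagram {m} {n} l G =
    (∀ i → IsTableau (rowOf G i))
  × (∀ j → IsTableau (colOf G j))
  × (∀ i i' (j : Fin n) → content (rowOf G i) j ≡ content (rowOf G i') j)
  × (∀ j j' (i : Fin m) → content (colOf G j) i ≡ content (colOf G j') i)
  × (∀ (i : Fin m) (j : Fin n) →
       LocalRule l (G (inject₁ i) (inject₁ j)) (G (inject₁ i) (fsuc j))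
                   (G (fsuc i) (inject₁ j)) (G (fsuc i) (fsuc j)))

InternalInsertion : ∀ {m n} → ℕ → Chain n → Chain m → Chain n → Chain m → Set
InternalInsertion {m} {n} l P Q T U =
  Σ (Array m n) λ G →
      IsGrowthDiagram l G
    × (∀ j → G (fromℕ m) j ≐ P j)
    × (∀ i → G i (fromℕ n) ≐ Q i)
    × (∀ j → G fzero j ≐ T j)
    × (∀ i → G i fzero ≐ U i)

-- Jeu de taquin.  Boxes are (row , column), 0-based; a filling assigns
-- entries to boxes.

Filling : Set
Filling = ℕ → ℕ → ℕ

-- the entry of box (r,c) in the tableau Q :  least i with c < β^i_r
fillingOf : ∀ {k} → Chain k → Filling
fillingOf {k} Q r c = suc (length (filterᵇ (λ j → part (Q (fsuc j)) r ≤ᵇ c) (allFin k)))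

update : Filling → ℕ → ℕ → ℕ → Filling
update f r c v r' c' = if (r' ≡ᵇ r) ∧ (c' ≡ᵇ c) then v else f r' c'

-- Moves right/down to the smaller neighbour (down if equal).
-- The fuel (number of moves allowed) is chosen larger than the number of
-- boxes, so it is never exhausted.
slideF : ℕ → Partition → Filling → ℕ → ℕ → Filling × ℕ × ℕ
slideF zero    outer f r c = f , r , c
slideF (suc n) outer f r c =
  if suc c <ᵇ part outer r
  then (if c <ᵇ part outer (suc r)
        then (if f r (suc c) <ᵇ f (suc r) c then goRight else goDown)
        else goRight)
  else (if c <ᵇ part outer (suc r) then goDown else (f , r , c))
  where
  goRight = slideF n outer (update f r c (f r (suc c))) r (suc c)
  goDown  = slideF n outer (update f r c (f (suc r) c)) (suc r) c

slide : Partition → Filling → ℕ → ℕ → Filling × ℕ × ℕ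
slide outer = slideF (suc (sum outer)) outer

decRow : Partition → ℕ → Partition
decRow []       _       = []
decRow (x ∷ xs) zero    = (x ∸ 1) ∷ xs
decRow (x ∷ xs) (suc r) = x ∷ decRow xs r

-- boxes of the skew shape β/α ordered by decreasing column
-- (= decreasing standard numbering within a horizontal strip)
stripBoxes : Partition → Partition → List (ℕ × ℕ)
stripBoxes α β =
  concatMap (λ c → map (λ r → r , c)
                       (filterᵇ (λ r → (part α r ≤ᵇ c) ∧ (c <ᵇ part β r)) (upTo (length β))))
            (downFrom (part β 0))

-- boxes of P with their entries, in decreasing order of the standard
-- renumbering (strips i = k,...,1; within a strip right to left)
boxesP : ∀ {k} → Chain k → List ((ℕ × ℕ) × ℕ)
boxesP {k} P =
  concatMap (λ (j : Fin k) → map (λ b → b , suc (toℕ j)) (stripBoxes (P (inject₁ j)) (P (fsuc j))))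
            (reverse (allFin k))

-- state: current filling, current outer shape, vacated boxes (row, col, entry)
JState : Set
JState = Filling × Partition × List (ℕ × ℕ × ℕ)

jstep : JState → (ℕ × ℕ) × ℕ → JState
jstep (f , outer , vac) ((r , c) , e) with slide outer f r c
... | f' , vr , vc = f' , decRow outer vr , ((vr , vc , e) ∷ vac)

countᵇ : ∀ {A : Set} → (A → Bool) → List A → ℕ
countᵇ p xs = length (filterᵇ p xs)

jdt : ∀ {k k'} → Chain k → Chain k' → Chain k × Chain k'
jdt {k} {k'} P Q = T , U
  where
  δ α : Partition
  δ = outerB Q
  α = innerB P
  final : JState
  final = foldl jstep (fillingOf Q , δ , []) (boxesP P)
  f : Filling
  f = proj₁ final
  ε : Partition
  ε = proj₁ (proj₂ final)
  vac : List (ℕ × ℕ × ℕ)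
  vac = proj₂ (proj₂ final)
  U : Chain k'
  U j = map (λ r → part α r
                   + countᵇ (λ c → (part α r ≤ᵇ c) ∧ (f r c ≤ᵇ toℕ j)) (upTo (part ε r)))
            (upTo (length δ))
  -- T : outer border δ, boxes = vacated outer corners with their entries
  T : Chain k
  T j = map (λ r → part ε r
                   + countᵇ (λ v → (proj₁ v ≡ᵇ r) ∧ (proj₂ (proj₂ v) ≤ᵇ toℕ j)) vac)
            (upTo (length δ))

{-# OPTIONS --safe #-}

-- Follow a jeu de taquin slide through the entries of Q one value at a
-- time: after the entries ≤ m the empty box sits at the end of a row ρ of
-- β^m, and passing the entries m + 1 it either stays in row ρ or drops to
-- row ρ + 1, the latter exactly when β^m_ρ ≤ β^{m+1}_{ρ+1}. When all boxes
-- of a horizontal strip β^0/α of P are slid into from right to left, the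
-- slides leave every level in runs of rows that can be counted row by
-- row, and the count shows that the new tableau α = γ^0 ⊆ ⋯ ⊆ γ^{k'}
-- satisfies (l, β^m) = R(γ^{m+1}; β^{m+1}, (l, γ^m)). So, after prepending
-- rows of length l, the tableaux met during the jeu de taquin fill a
-- growth diagram for R whose last row is P and last column Q^C. As R
-- determines the upper left corner of a square from the other three, this
-- is the diagram of internal insertion, and its first row and column are
-- T and U^C.

module Submission where

open import Defs
open import Data.Nat using (ℕ; zero; suc; _+_; _∸_; _≤_; _<_; _⊔_; _⊓_; _≤ᵇ_; _<ᵇ_; _≡ᵇ_; z≤n; s≤s; _≤?_; _<?_; _≟_)
open import Data.Nat.Properties
open import Data.Bool using (Bool; true; false; if_then_else_; _∧_; T)
open import Data.Nat.ListAction using (sum)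
open import Data.Empty using (⊥; ⊥-elim)
open import Data.Unit using (⊤; tt)
open import Data.Fin using (Fin; toℕ; fromℕ; inject₁; opposite; fromℕ<) renaming (zero to fzero; suc to fsuc)
open import Data.Fin.Properties using (toℕ-inject₁; toℕ-fromℕ<; toℕ<n; opposite-prop)
open import Data.List using (List; []; _∷_; _++_; replicate; length; map; foldl; foldr; filterᵇ; applyUpTo; upTo; downFrom; concatMap; reverse; allFin; tabulate)
open import Data.List.Properties using (++-assoc; concatMap-++; foldl-++; reverse-foldl; length-++; filter-++)
open import Data.Product using (_×_; _,_; Σ; proj₁; proj₂)
open import Data.Sum using (_⊎_; inj₁; inj₂; [_,_]′)
open import Relation.Binary.Definitions using (tri<; tri≈; tri>)
open import Relation.Binary.PropositionalEquality
open import Relation.Nullary using (¬_; yes; no)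
open import Relation.Nullary.Decidable using (_×-dec_)

T⇒≡true : ∀ {b} → T b → b ≡ true
T⇒≡true {true} _ = refl

¬T⇒≡false : ∀ {b} → ¬ T b → b ≡ false
¬T⇒≡false {false} _ = refl
¬T⇒≡false {true} h = ⊥-elim (h tt)

<ᵇ-true : ∀ {m n} → m < n → (m <ᵇ n) ≡ true
<ᵇ-true m<n = T⇒≡true (<⇒<ᵇ m<n)

<ᵇ-false : ∀ {m n} → ¬ (m < n) → (m <ᵇ n) ≡ false
<ᵇ-false {m} {n} m≮n = ¬T⇒≡false (λ t → m≮n (<ᵇ⇒< m n t))

≤ᵇ-true : ∀ {m n} → m ≤ n → (m ≤ᵇ n) ≡ true
≤ᵇ-true m≤n = T⇒≡true (≤⇒≤ᵇ m≤n)

≤ᵇ-false : ∀ {m n} → ¬ (m ≤ n) → (m ≤ᵇ n) ≡ false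
≤ᵇ-false {m} {n} m≰n = ¬T⇒≡false (λ t → m≰n (≤ᵇ⇒≤ m n t))

≡ᵇ-refl : ∀ m → (m ≡ᵇ m) ≡ true
≡ᵇ-refl m = T⇒≡true (≡⇒≡ᵇ m m refl)

≡ᵇ-false : ∀ {m n} → ¬ (m ≡ n) → (m ≡ᵇ n) ≡ false
≡ᵇ-false {m} {n} m≢n = ¬T⇒≡false (λ t → m≢n (≡ᵇ⇒≡ m n t))

<⇒≤∸1 : ∀ {m n} → m < n → m ≤ n ∸ 1
<⇒≤∸1 = ∸-monoˡ-≤ 1

∸1< : ∀ {n} → 1 ≤ n → n ∸ 1 < n
∸1< {suc n} _ = ≤-refl

suc[∸1] : ∀ {n} → 1 ≤ n → suc (n ∸ 1) ≡ n
suc[∸1] = m+[n∸m]≡n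

Shape : Set
Shape = ℕ → ℕ

ShapeSeq : Set
ShapeSeq = ℕ → Shape

oneAt : ℕ → ℕ → ℕ
oneAt ρ r = if r ≡ᵇ ρ then 1 else 0

oneAt-here : ∀ ρ → oneAt ρ ρ ≡ 1
oneAt-here ρ rewrite ≡ᵇ-refl ρ = refl

oneAt-elsewhere : ∀ {ρ r} → ¬ (r ≡ ρ) → oneAt ρ r ≡ 0
oneAt-elsewhere r≢ρ rewrite ≡ᵇ-false r≢ρ = refl

removeBox : Shape → ℕ → Shape
removeBox g ρ r = g r ∸ oneAt ρ r

removeBox-here : ∀ g ρ → removeBox g ρ ρ ≡ g ρ ∸ 1
removeBox-here g ρ = cong (g ρ ∸_) (oneAt-here ρ)

removeBox-elsewhere : ∀ g ρ r → ¬ (r ≡ ρ) → removeBox g ρ r ≡ g r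
removeBox-elsewhere g ρ r r≢ρ = cong (g r ∸_) (oneAt-elsewhere r≢ρ)

removeBox-cong : ∀ {g h} → (∀ r → g r ≡ h r) → ∀ ρ r → removeBox g ρ r ≡ removeBox h ρ r
removeBox-cong g≗h ρ r = cong (_∸ oneAt ρ r) (g≗h r)

removeBoxes : Shape → ℕ → ℕ → Shape
removeBoxes g ρ n r = if r ≡ᵇ ρ then g r ∸ n else g r

removeBoxes-here : ∀ g ρ n → removeBoxes g ρ n ρ ≡ g ρ ∸ n
removeBoxes-here g ρ n rewrite ≡ᵇ-refl ρ = refl

removeBoxes-elsewhere : ∀ g ρ n r → ¬ (r ≡ ρ) → removeBoxes g ρ n r ≡ g r
removeBoxes-elsewhere g ρ n r r≢ρ rewrite ≡ᵇ-false r≢ρ = refl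

removeBoxes-zero : ∀ g ρ r → removeBoxes g ρ 0 r ≡ g r
removeBoxes-zero g ρ r with r ≡ᵇ ρ
... | true = refl
... | false = refl

removeBoxes-removeBox : ∀ g ρ n r → removeBoxes (removeBox g ρ) ρ n r ≡ removeBoxes g ρ (suc n) r
removeBoxes-removeBox g ρ n r with r ≟ ρ
... | yes refl = begin
  removeBoxes (removeBox g ρ) ρ n ρ ≡⟨ removeBoxes-here (removeBox g ρ) ρ n ⟩
  removeBox g ρ ρ ∸ n               ≡⟨ cong (_∸ n) (removeBox-here g ρ) ⟩
  g ρ ∸ 1 ∸ n                       ≡⟨ ∸-+-assoc (g ρ) 1 n ⟩
  g ρ ∸ suc n                       ≡⟨ removeBoxes-here g ρ (suc n) ⟨
  removeBoxes g ρ (suc n) ρ         ∎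
  where open ≡-Reasoning
... | no r≢ρ = begin
  removeBoxes (removeBox g ρ) ρ n r ≡⟨ removeBoxes-elsewhere (removeBox g ρ) ρ n r r≢ρ ⟩
  removeBox g ρ r                   ≡⟨ removeBox-elsewhere g ρ r r≢ρ ⟩
  g r                               ≡⟨ removeBoxes-elsewhere g ρ (suc n) r r≢ρ ⟨
  removeBoxes g ρ (suc n) r         ∎
  where open ≡-Reasoning

removeBoxes-cong : ∀ {g h} → (∀ r → g r ≡ h r) → ∀ ρ n r → removeBoxes g ρ n r ≡ removeBoxes h ρ n r
removeBoxes-cong g≗h ρ n r with r ≡ᵇ ρ
... | true = cong (_∸ n) (g≗h r)
... | false = g≗h r

-- Slides followed level by level

-- A slide whose empty box is at the end of row ρ of D = β^m passes through
-- the strip B/D = β^{m+1}/β^m and leaves it at the end of row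
-- nextRow D B ρ of B: it moves down exactly when the box below belongs to
-- the strip.
nextRow : Shape → Shape → ℕ → ℕ
nextRow D B ρ = if D ρ ≤ᵇ B (suc ρ) then suc ρ else ρ

nextRow-down : ∀ D B ρ → D ρ ≤ B (suc ρ) → nextRow D B ρ ≡ suc ρ
nextRow-down D B ρ h rewrite ≤ᵇ-true h = refl

nextRow-stay : ∀ D B ρ → B (suc ρ) < D ρ → nextRow D B ρ ≡ ρ
nextRow-stay D B ρ h rewrite ≤ᵇ-false (<⇒≱ h) = refl

nextRow-cong : ∀ D D' B B' ρ → D ρ ≡ D' ρ → B (suc ρ) ≡ B' (suc ρ) → nextRow D B ρ ≡ nextRow D' B' ρ
nextRow-cong D D' B B' ρ eD eB rewrite eD | eB = refl

nextRows : Shape → Shape → List ℕ → List ℕ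
nextRows D B [] = []
nextRows D B (ρ ∷ ρs) = nextRow D B ρ ∷ nextRows (removeBox D ρ) (removeBox B (nextRow D B ρ)) ρs

nextRows-cong : ∀ ρs {D D' B B'} → (∀ r → D r ≡ D' r) → (∀ r → B r ≡ B' r) → nextRows D B ρs ≡ nextRows D' B' ρs
nextRows-cong [] eD eB = refl
nextRows-cong (ρ ∷ ρs) {D} {D'} {B} {B'} eD eB =
  cong₂ _∷_ next≡ (nextRows-cong ρs (removeBox-cong eD ρ) (λ r → cong₂ _∸_ (eB r) (cong (λ s → oneAt s r) next≡)))
  where
  next≡ : nextRow D B ρ ≡ nextRow D' B' ρ
  next≡ = nextRow-cong D D' B B' ρ (eD ρ) (eB (suc ρ))

suc[n]⊓[m∸o]≡suc[n⊓[m∸1∸o]] : ∀ m o n → o < m → suc n ⊓ (m ∸ o) ≡ suc (n ⊓ (m ∸ 1 ∸ o))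
suc[n]⊓[m∸o]≡suc[n⊓[m∸1∸o]] (suc m) zero n _ = refl
suc[n]⊓[m∸o]≡suc[n⊓[m∸1∸o]] (suc m) (suc o) n (s≤s o<m) =
  trans (suc[n]⊓[m∸o]≡suc[n⊓[m∸1∸o]] m o n o<m) (cong (λ x → suc (n ⊓ x)) (∸-+-assoc m 1 o))

-- Of n successive slides from row ρ, the first s stay in row ρ while
-- there is room, the remaining d go down.
nextRows-replicate : ∀ n ρ D B ρs s d D' B' → s ≡ n ⊓ (D ρ ∸ B (suc ρ)) → d ≡ n ∸ s →
  (∀ r → D' r ≡ removeBoxes D ρ n r) → (∀ r → B' r ≡ removeBoxes (removeBoxes B ρ s) (suc ρ) d r) →
  nextRows D B (replicate n ρ ++ ρs) ≡ replicate s ρ ++ replicate d (suc ρ) ++ nextRows D' B' ρs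
nextRows-replicate zero ρ D B ρs .0 .0 D' B' refl refl eD eB =
  nextRows-cong ρs (λ r → sym (trans (eD r) (removeBoxes-zero D ρ r)))
                   (λ r → sym (trans (eB r) (trans (removeBoxes-zero (removeBoxes B ρ 0) (suc ρ) r) (removeBoxes-zero B ρ r))))
nextRows-replicate (suc n) ρ D B ρs s d D' B' es ed eD eB with D ρ ≤? B (suc ρ)
... | yes down rewrite nextRow-down D B ρ down | es | m≤n⇒m∸n≡0 down | ed =
  cong (suc ρ ∷_) (nextRows-replicate n ρ (removeBox D ρ) (removeBox B (suc ρ)) ρs 0 n D' B' noRoom refl
     (λ r → trans (eD r) (sym (removeBoxes-removeBox D ρ n r)))
     (λ r → trans (eB r) (trans (removeBoxes-cong (removeBoxes-zero B ρ) (suc ρ) (suc n) r)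
                   (trans (sym (removeBoxes-removeBox B (suc ρ) n r))
                          (sym (removeBoxes-cong (removeBoxes-zero (removeBox B (suc ρ)) ρ) (suc ρ) n r))))))
  where
  noRoom : 0 ≡ n ⊓ (removeBox D ρ ρ ∸ removeBox B (suc ρ) (suc ρ))
  noRoom = sym (trans (cong (n ⊓_) (trans (cong₂ _∸_ (removeBox-here D ρ) (removeBox-here B (suc ρ)))
           (m≤n⇒m∸n≡0 (∸-monoˡ-≤ 1 down)))) (⊓-zeroʳ n))
... | no stay rewrite nextRow-stay D B ρ (≰⇒> stay) | es | suc[n]⊓[m∸o]≡suc[n⊓[m∸1∸o]] (D ρ) (B (suc ρ)) n (≰⇒> stay) | ed =
  cong (ρ ∷_) (nextRows-replicate n ρ (removeBox D ρ) (removeBox B ρ) ρs s' (n ∸ s') D' B' room refl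
     (λ r → trans (eD r) (sym (removeBoxes-removeBox D ρ n r)))
     (λ r → trans (eB r) (removeBoxes-cong (λ r' → sym (removeBoxes-removeBox B ρ s' r')) (suc ρ) (n ∸ s') r)))
  where
  s' : ℕ
  s' = n ⊓ (D ρ ∸ 1 ∸ B (suc ρ))
  room : s' ≡ n ⊓ (removeBox D ρ ρ ∸ removeBox B ρ (suc ρ))
  room = cong (n ⊓_) (sym (cong₂ _∸_ (removeBox-here D ρ) (removeBox-elsewhere B ρ (suc ρ) (λ ()))))

replicate-++ : ∀ a b (x : ℕ) → replicate a x ++ replicate b x ≡ replicate (a + b) x
replicate-++ zero b x = refl
replicate-++ (suc a) b x = cong (x ∷_) (replicate-++ a b x)

-- The rows of the boxes of a horizontal strip listed from right to left:
-- row q, for ρ ≤ q < ρ + t, repeated n q times.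
stripRows : Shape → ℕ → ℕ → List ℕ
stripRows n ρ zero = []
stripRows n ρ (suc t) = replicate (n ρ) ρ ++ stripRows n (suc ρ) t

stripRows-cong : ∀ {n n'} → (∀ q → n q ≡ n' q) → ∀ ρ t → stripRows n ρ t ≡ stripRows n' ρ t
stripRows-cong e ρ zero = refl
stripRows-cong e ρ (suc t) = cong₂ _++_ (cong (λ a → replicate a ρ) (e ρ)) (stripRows-cong e (suc ρ) t)

stripRows-suc : ∀ n ρ t → n (t + ρ) ≡ 0 → stripRows n ρ (suc t) ≡ stripRows n ρ t
stripRows-suc n ρ zero h rewrite h = refl
stripRows-suc n ρ (suc t) h = cong (replicate (n ρ) ρ ++_) (stripRows-suc n (suc ρ) t (trans (cong n (+-suc t ρ)) h))

stripRows-pad : ∀ n t d → (∀ q → t ≤ q → n q ≡ 0) → stripRows n 0 (t + d) ≡ stripRows n 0 t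
stripRows-pad n t zero h = cong (stripRows n 0) (+-identityʳ t)
stripRows-pad n t (suc d) h =
  trans (cong (stripRows n 0) (+-suc t d))
        (trans (stripRows-suc n 0 (t + d) (h (t + d + 0) (≤-trans (m≤m+n t d) (m≤m+n _ 0)))) (stripRows-pad n t d h))

-- The inverse local rule

IsHStrip : Shape → Shape → Set
IsHStrip α β = ∀ q → α q ≤ β q × β (suc q) ≤ α q

IsHStripSeq : ShapeSeq → Set
IsHStripSeq C = ∀ m → IsHStrip (C m) (C (suc m))

ruleMin : Shape → Shape → Shape
ruleMin β Γ zero = β 0
ruleMin β Γ (suc q) = β (suc q) ⊓ Γ q

-- α = R⁻¹(β, γ, δ) for γ = (l, Γ) and δ = (l, D), with the initial part l
-- dropped: α_q = max(β_{q+1}, γ_{q+1}) + min(β_q, γ_q) − δ_{q+1}, and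
-- min(β_0, γ_0) = β_0 because l bounds every part.
inverseRule : Shape → Shape → Shape → Shape
inverseRule β Γ D q = ((β (suc q) ⊔ Γ q) + ruleMin β Γ q) ∸ D q

ruleColumn : Shape → ShapeSeq → ShapeSeq
ruleColumn α C zero = α
ruleColumn α C (suc m) = inverseRule (C (suc m)) (ruleColumn α C m) (C m)

ruleColumn-cong : ∀ {α α'} C → (∀ q → α q ≡ α' q) → ∀ m q → ruleColumn α C m q ≡ ruleColumn α' C m q
ruleColumn-cong C e zero q = e q
ruleColumn-cong {α} {α'} C e (suc m) q =
  cong₂ (λ x y → ((C (suc m) (suc q) ⊔ x) + y) ∸ C m q) (ruleColumn-cong C e m q) (ruleMin-cong q)
  where
  ruleMin-cong : ∀ q → ruleMin (C (suc m)) (ruleColumn α C m) q ≡ ruleMin (C (suc m)) (ruleColumn α' C m) q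
  ruleMin-cong zero = refl
  ruleMin-cong (suc q) = cong (C (suc m) (suc q) ⊓_) (ruleColumn-cong C e m q)

[n∸m]+[m+o∸n]≡o : ∀ {m n o} → m ≤ n → n ≤ o → (n ∸ m) + ((m + o) ∸ n) ≡ o
[n∸m]+[m+o∸n]≡o {m} {n} {o} m≤n n≤o = begin
    (n ∸ m) + ((m + o) ∸ n) ≡⟨ cong ((n ∸ m) +_) (+-∸-assoc m n≤o) ⟩
    (n ∸ m) + (m + (o ∸ n)) ≡⟨ +-assoc (n ∸ m) m _ ⟨
    ((n ∸ m) + m) + (o ∸ n) ≡⟨ cong (_+ (o ∸ n)) (m∸n+n≡m m≤n) ⟩
    n + (o ∸ n)             ≡⟨ m+[n∸m]≡n n≤o ⟩
    o                       ∎
  where open ≡-Reasoning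

[o∸m]∸[o∸n]≡n∸m : ∀ {m n o} → m ≤ n → n ≤ o → (o ∸ m) ∸ (o ∸ n) ≡ n ∸ m
[o∸m]∸[o∸n]≡n∸m {m} {n} {o} m≤n n≤o = begin
    (o ∸ m) ∸ (o ∸ n)             ≡⟨ cong (λ x → (x ∸ m) ∸ (o ∸ n)) (m∸n+n≡m n≤o) ⟨
    (((o ∸ n) + n) ∸ m) ∸ (o ∸ n) ≡⟨ cong (_∸ (o ∸ n)) (+-∸-assoc (o ∸ n) m≤n) ⟩
    ((o ∸ n) + (n ∸ m)) ∸ (o ∸ n) ≡⟨ m+n∸m≡n (o ∸ n) _ ⟩
    n ∸ m                         ∎
  where open ≡-Reasoning

[m⊔n]∸n≡m∸n : ∀ m n → (m ⊔ n) ∸ n ≡ m ∸ n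
[m⊔n]∸n≡m∸n m n with ≤-total m n
... | inj₁ m≤n rewrite m≤n⇒m⊔n≡n m≤n | n∸n≡0 n | m≤n⇒m∸n≡0 m≤n = refl
... | inj₂ n≤m rewrite m≥n⇒m⊔n≡m n≤m = refl

m∸n+m⊓n≡m : ∀ m n → (m ∸ n) + (m ⊓ n) ≡ m
m∸n+m⊓n≡m m n with ≤-total m n
... | inj₁ m≤n rewrite m≤n⇒m⊓n≡m m≤n | m≤n⇒m∸n≡0 m≤n = refl
... | inj₂ n≤m rewrite m≥n⇒m⊓n≡n n≤m = m∸n+n≡m n≤m

m≤m+o∸n : ∀ {n o} m → n ≤ o → m ≤ (m + o) ∸ n
m≤m+o∸n {n} {o} m n≤o = subst (m ≤_) (sym (+-∸-assoc m n≤o)) (m≤m+n m (o ∸ n))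

m+o∸n≤p : ∀ {m n o p} → m ≤ n → o ≤ p → (m + o) ∸ n ≤ p
m+o∸n≤p {m} {n} {o} {p} m≤n o≤p = ≤-trans (∸-monoˡ-≤ n (+-mono-≤ m≤n o≤p)) (≤-reflexive (m+n∸m≡n n p))

-- One level of the slides into the strip D/Γ: they start at the ends of
-- the rows of D/Γ (starts q in row q) and leave the strip B/D at the ends
-- of its rows (exits q in row q); B without these boxes is inverseRule B Γ D.
module StripLevel (D B Γ : Shape) (Γ⊆D : IsHStrip Γ D) (D⊆B : IsHStrip D B) where

  starts stays downs exits : Shape
  starts q = D q ∸ Γ q
  stays q = starts q ⊓ (D q ∸ B (suc q))
  downs zero = 0
  downs (suc q) = starts q ∸ stays q
  exits q = downs q + stays q

  nextRows-stripRows : ∀ t ρ D' B' → (∀ q → ρ ≤ q → D' q ≡ D q) → (∀ q → ρ < q → B' q ≡ B q) → starts (t + ρ) ≡ 0 →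
    replicate (downs ρ) ρ ++ nextRows D' B' (stripRows starts ρ t) ≡ stripRows exits ρ (suc t)
  nextRows-stripRows zero ρ D' B' eD eB h rewrite h | +-identityʳ (downs ρ) = refl
  nextRows-stripRows (suc t) ρ D' B' eD eB h = begin
      replicate (downs ρ) ρ ++ nextRows D' B' (replicate (starts ρ) ρ ++ stripRows starts (suc ρ) t)
    ≡⟨ cong (replicate (downs ρ) ρ ++_) (nextRows-replicate (starts ρ) ρ D' B' (stripRows starts (suc ρ) t)
                                            (stays ρ) (downs (suc ρ)) D'' B'' stays≡ refl (λ r → refl) (λ r → refl)) ⟩
      replicate (downs ρ) ρ ++ (replicate (stays ρ) ρ ++ (replicate (downs (suc ρ)) (suc ρ) ++ nextRows D'' B'' (stripRows starts (suc ρ) t)))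
    ≡⟨ ++-assoc (replicate (downs ρ) ρ) _ _ ⟨
      (replicate (downs ρ) ρ ++ replicate (stays ρ) ρ) ++ (replicate (downs (suc ρ)) (suc ρ) ++ nextRows D'' B'' (stripRows starts (suc ρ) t))
    ≡⟨ cong₂ _++_ (replicate-++ (downs ρ) (stays ρ) ρ) (nextRows-stripRows t (suc ρ) D'' B'' eD'' eB'' h') ⟩
      replicate (exits ρ) ρ ++ stripRows exits (suc ρ) (suc t)
    ∎
    where
    open ≡-Reasoning
    D'' B'' : Shape
    D'' = removeBoxes D' ρ (starts ρ)
    B'' = removeBoxes (removeBoxes B' ρ (stays ρ)) (suc ρ) (downs (suc ρ))
    stays≡ : stays ρ ≡ starts ρ ⊓ (D' ρ ∸ B' (suc ρ))
    stays≡ = cong₂ (λ a b → starts ρ ⊓ (a ∸ b)) (sym (eD ρ ≤-refl)) (sym (eB (suc ρ) ≤-refl))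
    eD'' : ∀ q → suc ρ ≤ q → D'' q ≡ D q
    eD'' q ρ<q = trans (removeBoxes-elsewhere D' ρ (starts ρ) q (λ e → 1+n≰n (subst (suc ρ ≤_) e ρ<q))) (eD q (≤-trans (n≤1+n ρ) ρ<q))
    eB'' : ∀ q → suc ρ < q → B'' q ≡ B q
    eB'' q ρ+1<q = trans (removeBoxes-elsewhere (removeBoxes B' ρ (stays ρ)) (suc ρ) (downs (suc ρ)) q (λ e → 1+n≰n (subst (suc ρ <_) e ρ+1<q)))
               (trans (removeBoxes-elsewhere B' ρ (stays ρ) q (λ e → 1+n≰n (≤-trans (n≤1+n _) (subst (suc ρ <_) e ρ+1<q))))
                      (eB q (≤-trans (n≤1+n _) ρ+1<q)))
    h' : starts (t + suc ρ) ≡ 0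
    h' = trans (cong starts (+-suc t ρ)) h

  Γ' : Shape
  Γ' = inverseRule B Γ D

  D≤ruleMin : ∀ q → D q ≤ ruleMin B Γ q
  D≤ruleMin zero = proj₁ (D⊆B 0)
  D≤ruleMin (suc q) = ⊓-glb (proj₁ (D⊆B (suc q))) (proj₂ (Γ⊆D q))

  private
    upper : Shape
    upper q = B (suc q) ⊔ Γ q

    upper≤D : ∀ q → upper q ≤ D q
    upper≤D q = ⊔-lub (proj₂ (D⊆B q)) (proj₁ (Γ⊆D q))

    stays≡D∸upper : ∀ q → stays q ≡ D q ∸ upper q
    stays≡D∸upper q = trans (⊓-comm (D q ∸ Γ q) _) (sym (∸-distribˡ-⊔-⊓ (D q) (B (suc q)) (Γ q)))

    downs+ruleMin≡B : ∀ q → downs q + ruleMin B Γ q ≡ B q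
    downs+ruleMin≡B zero = refl
    downs+ruleMin≡B (suc q) = begin
        (starts q ∸ stays q) + ruleMin B Γ (suc q)
      ≡⟨ cong (λ x → (starts q ∸ x) + ruleMin B Γ (suc q)) (stays≡D∸upper q) ⟩
        ((D q ∸ Γ q) ∸ (D q ∸ upper q)) + ruleMin B Γ (suc q)
      ≡⟨ cong (_+ ruleMin B Γ (suc q)) (trans ([o∸m]∸[o∸n]≡n∸m (m≤n⊔m (B (suc q)) (Γ q)) (upper≤D q)) ([m⊔n]∸n≡m∸n (B (suc q)) (Γ q))) ⟩
        (B (suc q) ∸ Γ q) + (B (suc q) ⊓ Γ q)
      ≡⟨ m∸n+m⊓n≡m (B (suc q)) (Γ q) ⟩
        B (suc q)
      ∎
      where open ≡-Reasoning

  exits+Γ'≡B : ∀ q → exits q + Γ' q ≡ B q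
  exits+Γ'≡B q = begin
      (downs q + stays q) + Γ' q               ≡⟨ +-assoc (downs q) (stays q) (Γ' q) ⟩
      downs q + (stays q + Γ' q)               ≡⟨ cong (λ x → downs q + (x + Γ' q)) (stays≡D∸upper q) ⟩
      downs q + ((D q ∸ upper q) + Γ' q)       ≡⟨ cong (downs q +_) ([n∸m]+[m+o∸n]≡o (upper≤D q) (D≤ruleMin q)) ⟩
      downs q + ruleMin B Γ q                  ≡⟨ downs+ruleMin≡B q ⟩
      B q                                      ∎
    where open ≡-Reasoning

  exits≡B∸Γ' : ∀ q → exits q ≡ B q ∸ Γ' q
  exits≡B∸Γ' q = sym (trans (cong (_∸ Γ' q) (sym (exits+Γ'≡B q))) (m+n∸n≡m (exits q) (Γ' q)))

  Γ'⊆B : IsHStrip Γ' B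
  Γ'⊆B q = subst (Γ' q ≤_) (exits+Γ'≡B q) (m≤n+m (Γ' q) (exits q)) ,
           ≤-trans (m≤m⊔n (B (suc q)) (Γ q)) (m≤m+o∸n (upper q) (D≤ruleMin q))

  Γ⊆Γ' : IsHStrip Γ Γ'
  Γ⊆Γ' q = ≤-trans (m≤n⊔m (B (suc q)) (Γ q)) (m≤m+o∸n (upper q) (D≤ruleMin q)) ,
           m+o∸n≤p (upper≤D (suc q)) (m⊓n≤n (B (suc q)) (Γ q))

slidePath : ShapeSeq → ℕ → ℕ → ℕ
slidePath C ρ zero = ρ
slidePath C ρ (suc m) = nextRow (C m) (C (suc m)) (slidePath C ρ m)

afterSlide : ShapeSeq → ℕ → ShapeSeq
afterSlide C ρ m = removeBox (C m) (slidePath C ρ m)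

afterSlides : ShapeSeq → List ℕ → ShapeSeq
afterSlides C [] = C
afterSlides C (ρ ∷ ρs) = afterSlides (afterSlide C ρ) ρs

slidePaths : ShapeSeq → List ℕ → ℕ → List ℕ
slidePaths C [] m = []
slidePaths C (ρ ∷ ρs) m = slidePath C ρ m ∷ slidePaths (afterSlide C ρ) ρs m

slidePaths-zero : ∀ ρs C → slidePaths C ρs 0 ≡ ρs
slidePaths-zero [] C = refl
slidePaths-zero (ρ ∷ ρs) C = cong (ρ ∷_) (slidePaths-zero ρs (afterSlide C ρ))

slidePaths-suc : ∀ ρs C m → slidePaths C ρs (suc m) ≡ nextRows (C m) (C (suc m)) (slidePaths C ρs m)
slidePaths-suc [] C m = refl
slidePaths-suc (ρ ∷ ρs) C m = cong (slidePath C ρ (suc m) ∷_) (slidePaths-suc ρs (afterSlide C ρ) m)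

occurrences : ℕ → List ℕ → ℕ
occurrences q [] = 0
occurrences q (x ∷ xs) = oneAt x q + occurrences q xs

afterSlides≡∸occurrences : ∀ ρs C m q → afterSlides C ρs m q ≡ C m q ∸ occurrences q (slidePaths C ρs m)
afterSlides≡∸occurrences [] C m q = refl
afterSlides≡∸occurrences (ρ ∷ ρs) C m q =
  trans (afterSlides≡∸occurrences ρs (afterSlide C ρ) m q) (∸-+-assoc (C m q) (oneAt (slidePath C ρ m) q) _)

occurrences-++ : ∀ q xs ys → occurrences q (xs ++ ys) ≡ occurrences q xs + occurrences q ys
occurrences-++ q [] ys = refl
occurrences-++ q (x ∷ xs) ys = trans (cong (oneAt x q +_) (occurrences-++ q xs ys)) (sym (+-assoc (oneAt x q) _ _))

occurrences-replicate-here : ∀ q a → occurrences q (replicate a q) ≡ a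
occurrences-replicate-here q zero = refl
occurrences-replicate-here q (suc a) = cong₂ _+_ (oneAt-here q) (occurrences-replicate-here q a)

occurrences-replicate-elsewhere : ∀ q x a → ¬ (q ≡ x) → occurrences q (replicate a x) ≡ 0
occurrences-replicate-elsewhere q x zero q≢x = refl
occurrences-replicate-elsewhere q x (suc a) q≢x = cong₂ _+_ (oneAt-elsewhere q≢x) (occurrences-replicate-elsewhere q x a q≢x)

occurrences-stripRows-outside : ∀ n q ρ t → (q < ρ) ⊎ (t + ρ ≤ q) → occurrences q (stripRows n ρ t) ≡ 0
occurrences-stripRows-outside n q ρ zero h = refl
occurrences-stripRows-outside n q ρ (suc t) h =
  trans (occurrences-++ q (replicate (n ρ) ρ) _)
        (cong₂ _+_ (occurrences-replicate-elsewhere q ρ (n ρ) q≢ρ) (occurrences-stripRows-outside n q (suc ρ) t h'))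
  where
  q≢ρ : ¬ (q ≡ ρ)
  q≢ρ e = [ (λ q<ρ → <-irrefl e q<ρ) , (λ t+ρ<q → 1+n≰n (≤-trans (≤-trans (s≤s (m≤n+m ρ t)) t+ρ<q) (≤-reflexive e))) ]′ h
  h' : (q < suc ρ) ⊎ (t + suc ρ ≤ q)
  h' = [ (λ q<ρ → inj₁ (≤-trans q<ρ (n≤1+n _))) , (λ t+ρ<q → inj₂ (subst (_≤ q) (sym (+-suc t ρ)) t+ρ<q)) ]′ h

occurrences-stripRows-inside : ∀ n q ρ t → ρ ≤ q → q < t + ρ → occurrences q (stripRows n ρ t) ≡ n q
occurrences-stripRows-inside n q ρ zero ρ≤q q<ρ = ⊥-elim (<-irrefl refl (≤-trans q<ρ ρ≤q))
occurrences-stripRows-inside n q ρ (suc t) ρ≤q q<t+ρ with q ≟ ρ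
... | yes refl =
  trans (occurrences-++ q (replicate (n q) q) _)
        (trans (cong₂ _+_ (occurrences-replicate-here q (n q)) (occurrences-stripRows-outside n q (suc q) t (inj₁ ≤-refl)))
               (+-identityʳ (n q)))
... | no q≢ρ =
  trans (occurrences-++ q (replicate (n ρ) ρ) _)
        (cong₂ _+_ (occurrences-replicate-elsewhere q ρ (n ρ) q≢ρ)
                   (occurrences-stripRows-inside n q (suc ρ) t (≤∧≢⇒< ρ≤q (λ e → q≢ρ (sym e))) (subst (q <_) (sym (+-suc t ρ)) q<t+ρ)))

-- Sliding into the boxes of the strip C 0 / α from right to left turns C
-- into ruleColumn α C.
module StripSlides (C : ShapeSeq) (α : Shape) (N : ℕ) (ρs : List ℕ) (C-strips : IsHStripSeq C) (α⊆C₀ : IsHStrip α (C 0))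
                   (C-short : ∀ m q → N ≤ q → C m q ≡ 0) (ρs≡ : ρs ≡ stripRows (λ q → C 0 q ∸ α q) 0 N) where

  column : ∀ m → IsHStrip (ruleColumn α C m) (C m) × (slidePaths C ρs m ≡ stripRows (λ q → C m q ∸ ruleColumn α C m q) 0 N)
  column zero = α⊆C₀ , trans (slidePaths-zero ρs C) ρs≡
  column (suc m) = L.Γ'⊆B , paths≡
    where
    IH : IsHStrip (ruleColumn α C m) (C m) × (slidePaths C ρs m ≡ stripRows (λ q → C m q ∸ ruleColumn α C m q) 0 N)
    IH = column m
    module L = StripLevel (C m) (C (suc m)) (ruleColumn α C m) (proj₁ IH) (C-strips m)
    noStarts : L.starts (N + 0) ≡ 0
    noStarts = trans (cong (_∸ ruleColumn α C m (N + 0)) (C-short m (N + 0) (m≤m+n N 0))) (0∸n≡0 (ruleColumn α C m (N + 0)))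
    noExits : L.exits (N + 0) ≡ 0
    noExits = n≤0⇒n≡0 (subst (L.exits (N + 0) ≤_) (trans (L.exits+Γ'≡B (N + 0)) (C-short (suc m) (N + 0) (m≤m+n N 0))) (m≤m+n _ _))
    open ≡-Reasoning
    paths≡ : slidePaths C ρs (suc m) ≡ stripRows (λ q → C (suc m) q ∸ ruleColumn α C (suc m) q) 0 N
    paths≡ = begin
      slidePaths C ρs (suc m)                       ≡⟨ slidePaths-suc ρs C m ⟩
      nextRows (C m) (C (suc m)) (slidePaths C ρs m) ≡⟨ cong (nextRows (C m) (C (suc m))) (proj₂ IH) ⟩
      nextRows (C m) (C (suc m)) (stripRows L.starts 0 N)
        ≡⟨ L.nextRows-stripRows N 0 (C m) (C (suc m)) (λ _ _ → refl) (λ _ _ → refl) noStarts ⟩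
      stripRows L.exits 0 (suc N)                    ≡⟨ stripRows-suc L.exits 0 N noExits ⟩
      stripRows L.exits 0 N                          ≡⟨ stripRows-cong L.exits≡B∸Γ' 0 N ⟩
      stripRows (λ q → C (suc m) q ∸ ruleColumn α C (suc m) q) 0 N ∎

  afterSlides≡ruleColumn : ∀ m q → afterSlides C ρs m q ≡ ruleColumn α C m q
  afterSlides≡ruleColumn m q with q <? N
  ... | yes q<N = begin
      afterSlides C ρs m q                                    ≡⟨ afterSlides≡∸occurrences ρs C m q ⟩
      C m q ∸ occurrences q (slidePaths C ρs m)               ≡⟨ cong (λ l → C m q ∸ occurrences q l) (proj₂ (column m)) ⟩
      C m q ∸ occurrences q (stripRows (λ q → C m q ∸ ruleColumn α C m q) 0 N)
        ≡⟨ cong (C m q ∸_) (occurrences-stripRows-inside _ q 0 N z≤n (subst (q <_) (sym (+-identityʳ N)) q<N)) ⟩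
      C m q ∸ (C m q ∸ ruleColumn α C m q)                    ≡⟨ m∸[m∸n]≡n (proj₁ (proj₁ (column m) q)) ⟩
      ruleColumn α C m q                                      ∎
    where open ≡-Reasoning
  ... | no q≮N = begin
      afterSlides C ρs m q                      ≡⟨ afterSlides≡∸occurrences ρs C m q ⟩
      C m q ∸ occurrences q (slidePaths C ρs m) ≡⟨ cong (_∸ occurrences q (slidePaths C ρs m)) (C-short m q (≮⇒≥ q≮N)) ⟩
      0 ∸ occurrences q (slidePaths C ρs m)     ≡⟨ 0∸n≡0 (occurrences q (slidePaths C ρs m)) ⟩
      0                                         ≡⟨ n≤0⇒n≡0 (subst (ruleColumn α C m q ≤_) (C-short m q (≮⇒≥ q≮N)) (proj₁ (proj₁ (column m) q))) ⟨
      ruleColumn α C m q                        ∎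
    where open ≡-Reasoning

  occurrences-column : ∀ m r → occurrences r (slidePaths C ρs m) ≡ C m r ∸ ruleColumn α C m r
  occurrences-column m r with r <? N
  ... | yes r<N = trans (cong (occurrences r) (proj₂ (column m)))
                        (occurrences-stripRows-inside _ r 0 N z≤n (subst (r <_) (sym (+-identityʳ N)) r<N))
  ... | no r≮N = trans (cong (occurrences r) (proj₂ (column m)))
                       (trans (occurrences-stripRows-outside _ r 0 N (inj₂ (subst (_≤ r) (sym (+-identityʳ N)) (≮⇒≥ r≮N))))
                              (sym (trans (cong (_∸ ruleColumn α C m r) (C-short m r (≮⇒≥ r≮N))) (0∸n≡0 (ruleColumn α C m r)))))

  ruleColumn-isHStripSeq : IsHStripSeq (ruleColumn α C)
  ruleColumn-isHStripSeq m = StripLevel.Γ⊆Γ' (C m) (C (suc m)) (ruleColumn α C m) (proj₁ (column m)) (C-strips m)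

-- One jeu de taquin slide

seq-mono : (g : ℕ → ℕ) (K : ℕ) → (∀ j → j < K → g j ≤ g (suc j)) → ∀ i j → i ≤ j → j ≤ K → g i ≤ g j
seq-mono g K up i zero z≤n _ = ≤-refl
seq-mono g K up i (suc j) i≤j+1 j<K with i ≤? j
... | yes i≤j = ≤-trans (seq-mono g K up i j i≤j (≤-trans (n≤1+n j) j<K)) (up j j<K)
... | no i≰j = ≤-reflexive (cong g (≤-antisym i≤j+1 (≰⇒> i≰j)))

seq-antitone : (g : ℕ → ℕ) → (∀ i → g (suc i) ≤ g i) → ∀ i j → i ≤ j → g j ≤ g i
seq-antitone g down i zero z≤n = ≤-refl
seq-antitone g down i (suc j) i≤j+1 with i ≤? j
... | yes i≤j = ≤-trans (down j) (seq-antitone g down i j i≤j)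
... | no i≰j = ≤-reflexive (cong g (sym (≤-antisym i≤j+1 (≰⇒> i≰j))))

seq-step-unique : (g : ℕ → ℕ) (K : ℕ) → (∀ j → j < K → g j ≤ g (suc j)) → ∀ i j c → i < K → j < K →
                  g i ≤ c → c < g (suc i) → g j ≤ c → c < g (suc j) → i ≡ j
seq-step-unique g K up i j c i<K j<K gi≤c c<gi' gj≤c c<gj' with <-cmp i j
... | tri< i<j _ _ = ⊥-elim (<-irrefl refl (<-≤-trans c<gi' (≤-trans (seq-mono g K up (suc i) j i<j (<⇒≤ j<K)) gj≤c)))
... | tri≈ _ i≡j _ = i≡j
... | tri> _ _ j<i = ⊥-elim (<-irrefl refl (<-≤-trans c<gj' (≤-trans (seq-mono g K up (suc j) i j<i (<⇒≤ i<K)) gi≤c)))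

seq-crossing : (g : ℕ → ℕ) (c : ℕ) → ∀ b a → a ≤ b → g a ≤ c → c < g b →
               Σ ℕ (λ j → a ≤ j × j < b × g j ≤ c × c < g (suc j))
seq-crossing g c zero .zero z≤n ga≤c c<gb = ⊥-elim (<-irrefl refl (<-≤-trans c<gb ga≤c))
seq-crossing g c (suc b) a a≤b+1 ga≤c c<gb+1 with a ≤? b
... | no a≰b = ⊥-elim (<-irrefl refl (<-≤-trans c<gb+1 (≤-trans (≤-reflexive (cong g (sym (≤-antisym a≤b+1 (≰⇒> a≰b))))) ga≤c)))
... | yes a≤b with g b ≤? c
...   | yes gb≤c = b , a≤b , ≤-refl , gb≤c , c<gb+1
...   | no gb≰c = let (j , a≤j , j<b , gj≤c , c<gj') = seq-crossing g c b a a≤b ga≤c (≰⇒> gb≰c)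
                  in j , a≤j , ≤-trans j<b (n≤1+n b) , gj≤c , c<gj'

Fills : ℕ → ShapeSeq → Filling → Set
Fills K C f = ∀ m r c → m < K → C m r ≤ c → c < C (suc m) r → f r c ≡ suc m

update-here : ∀ f r c v → update f r c v r c ≡ v
update-here f r c v rewrite ≡ᵇ-refl r | ≡ᵇ-refl c = refl

update-elsewhere : ∀ f r c v r' c' → ¬ (r' ≡ r × c' ≡ c) → update f r c v r' c' ≡ f r' c'
update-elsewhere f r c v r' c' h with r' ≟ r | c' ≟ c
... | yes r'≡r | yes c'≡c = ⊥-elim (h (r'≡r , c'≡c))
... | yes refl | no c'≢c rewrite ≡ᵇ-false c'≢c | ≡ᵇ-refl r = refl
... | no r'≢r | _ rewrite ≡ᵇ-false r'≢r = refl

module SlideFStep (n : ℕ) (outer : Partition) (f : Filling) (r c : ℕ) where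
  right down : Filling × ℕ × ℕ
  right = slideF n outer (update f r c (f r (suc c))) r (suc c)
  down = slideF n outer (update f r c (f (suc r) c)) (suc r) c

  stop : (suc c <ᵇ part outer r) ≡ false → (c <ᵇ part outer (suc r)) ≡ false → slideF (suc n) outer f r c ≡ (f , r , c)
  stop e₁ e₂ rewrite e₁ | e₂ = refl

  right-only : (suc c <ᵇ part outer r) ≡ true → (c <ᵇ part outer (suc r)) ≡ false → slideF (suc n) outer f r c ≡ right
  right-only e₁ e₂ rewrite e₁ | e₂ = refl

  right-smaller : (suc c <ᵇ part outer r) ≡ true → (c <ᵇ part outer (suc r)) ≡ true → (f r (suc c) <ᵇ f (suc r) c) ≡ true →
                  slideF (suc n) outer f r c ≡ right
  right-smaller e₁ e₂ e₃ rewrite e₁ | e₂ | e₃ = refl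

  down-not-smaller : (suc c <ᵇ part outer r) ≡ true → (c <ᵇ part outer (suc r)) ≡ true → (f r (suc c) <ᵇ f (suc r) c) ≡ false →
                     slideF (suc n) outer f r c ≡ down
  down-not-smaller e₁ e₂ e₃ rewrite e₁ | e₂ | e₃ = refl

  down-only : (suc c <ᵇ part outer r) ≡ false → (c <ᵇ part outer (suc r)) ≡ true → slideF (suc n) outer f r c ≡ down
  down-only e₁ e₂ rewrite e₁ | e₂ = refl

row+col<size : ∀ (λs : Partition) → (∀ i → part λs (suc i) ≤ part λs i) → ∀ r c → c < part λs r → suc (r + c) ≤ sum λs
row+col<size (x ∷ xs) h zero c c<x = ≤-trans c<x (m≤m+n x (sum xs))
row+col<size (x ∷ xs) h (suc r) c c<xs =
  +-mono-≤ (≤-trans (≤-trans (s≤s z≤n) c<xs) (seq-antitone (part (x ∷ xs)) h 0 (suc r) z≤n)) (row+col<size xs (λ i → h (suc i)) r c c<xs)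

inStrip-removeLast : (E E' : ShapeSeq) (L ρ v : ℕ) → (∀ j r → ¬ (j ≡ L × r ≡ ρ) → E' j r ≡ E j r) → E' L ρ ≡ v → E L ρ ≡ suc v →
   ∀ j r c → ¬ (r ≡ ρ × c ≡ v) → E' j r ≤ c → c < E' (suc j) r → E j r ≤ c × c < E (suc j) r
inStrip-removeLast E E' L ρ v same E'Lρ ELρ j r c not-v lower upper = lower' , upper'
  where
  lower' : E j r ≤ c
  lower' with j ≟ L | r ≟ ρ
  ... | yes refl | yes refl = subst (_≤ c) (sym ELρ) (≤∧≢⇒< (subst (_≤ c) E'Lρ lower) (λ e → not-v (refl , sym e)))
  ... | yes _ | no r≢ρ = subst (_≤ c) (same j r (λ z → r≢ρ (proj₂ z))) lower
  ... | no j≢L | _ = subst (_≤ c) (same j r (λ z → j≢L (proj₁ z))) lower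
  upper' : c < E (suc j) r
  upper' with suc j ≟ L | r ≟ ρ
  ... | yes j+1≡L | yes refl = subst (c <_) (sym (trans (cong (λ z → E z r) j+1≡L) ELρ))
                                 (≤-trans (subst (c <_) (trans (cong (λ z → E' z r) j+1≡L) E'Lρ) upper) (n≤1+n v))
  ... | yes _ | no r≢ρ = subst (c <_) (same (suc j) r (λ z → r≢ρ (proj₂ z))) upper
  ... | no j+1≢L | _ = subst (c <_) (same (suc j) r (λ z → j+1≢L (proj₁ z))) upper

part-decRow : ∀ (λs : Partition) ρ r → part (decRow λs ρ) r ≡ part λs r ∸ oneAt ρ r
part-decRow [] ρ r = sym (0∸n≡0 (oneAt ρ r))
part-decRow (x ∷ xs) zero zero = refl
part-decRow (x ∷ xs) zero (suc r) = refl
part-decRow (x ∷ xs) (suc ρ) zero = refl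
part-decRow (x ∷ xs) (suc ρ) (suc r) = part-decRow xs ρ r

-- The slide into the last box of row r₀ of C 0 in a filling of the
-- tableau C 0 ⊆ ⋯ ⊆ C K (with outer shape `outer`) follows slidePath C r₀
-- and leaves a filling of afterSlide C r₀.
module OneSlide (K : ℕ) (C : ShapeSeq) (r₀ : ℕ) (outer : Partition)
  (C-parts : ∀ m → m ≤ K → ∀ q → C m (suc q) ≤ C m q)
  (C-strips : ∀ m → m < K → IsHStrip (C m) (C (suc m)))
  (outer≡ : ∀ r → part outer r ≡ C K r)
  (corner : C 0 (suc r₀) < C 0 r₀) where

  path : ℕ → ℕ
  path = slidePath C r₀

  S : ShapeSeq
  S = afterSlide C r₀

  C-mono : ∀ r i j → i ≤ j → j ≤ K → C i r ≤ C j r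
  C-mono r = seq-mono (λ m → C m r) K (λ j j<K → proj₁ (C-strips j j<K r))

  path-down : ∀ m → C m (path m) ≤ C (suc m) (suc (path m)) → path (suc m) ≡ suc (path m)
  path-down m = nextRow-down (C m) (C (suc m)) (path m)

  path-stay : ∀ m → C (suc m) (suc (path m)) < C m (path m) → path (suc m) ≡ path m
  path-stay m = nextRow-stay (C m) (C (suc m)) (path m)

  path-corner : ∀ m → m ≤ K → C m (suc (path m)) < C m (path m)
  path-corner zero _ = corner
  path-corner (suc m) m<K with C m (path m) ≤? C (suc m) (suc (path m))
  ... | yes d = subst (λ z → C (suc m) (suc z) < C (suc m) z) (sym (path-down m d))
                  (<-≤-trans (≤-<-trans (proj₂ (C-strips m m<K (suc (path m)))) (path-corner m (≤-trans (n≤1+n m) m<K))) d)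
  ... | no nd = subst (λ z → C (suc m) (suc z) < C (suc m) z) (sym (path-stay m (≰⇒> nd)))
                  (<-≤-trans (≰⇒> nd) (proj₁ (C-strips m m<K (path m))))

  path-nonempty : ∀ m → m ≤ K → 1 ≤ C m (path m)
  path-nonempty m m≤K = ≤-trans (s≤s z≤n) (path-corner m m≤K)

  S-here : ∀ m → S m (path m) ≡ C m (path m) ∸ 1
  S-here m = removeBox-here (C m) (path m)

  S-elsewhere : ∀ m r → ¬ (r ≡ path m) → S m r ≡ C m r
  S-elsewhere m r = removeBox-elsewhere (C m) (path m) r

  S≤C : ∀ m r → S m r ≤ C m r
  S≤C m r = m∸n≤m (C m r) (oneAt (path m) r)

  S-below-path : ∀ m → S m (suc (path m)) ≡ C m (suc (path m))
  S-below-path m = S-elsewhere m (suc (path m)) 1+n≢n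

  S-parts : ∀ m → m ≤ K → ∀ q → S m (suc q) ≤ S m q
  S-parts m m≤K q with q ≟ path m
  ... | yes refl = subst₂ _≤_ (sym (S-below-path m)) (sym (S-here m)) (<⇒≤∸1 (path-corner m m≤K))
  ... | no q≢path = subst (S m (suc q) ≤_) (sym (S-elsewhere m q q≢path)) (≤-trans (S≤C m (suc q)) (C-parts m m≤K q))

  S-strips : ∀ m → m < K → IsHStrip (S m) (S (suc m))
  S-strips m m<K q with C m (path m) ≤? C (suc m) (suc (path m))
  ... | yes d = lower , upper
    where
    S'-here : S (suc m) (suc (path m)) ≡ C (suc m) (suc (path m)) ∸ 1
    S'-here = trans (cong (λ z → removeBox (C (suc m)) z (suc (path m))) (path-down m d)) (removeBox-here (C (suc m)) (suc (path m)))
    lower : S m q ≤ S (suc m) q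
    lower with q ≟ suc (path m)
    ... | yes refl = subst₂ _≤_ (sym (S-below-path m)) (sym S'-here) (<⇒≤∸1 (<-≤-trans (path-corner m (<⇒≤ m<K)) d))
    ... | no q≢ = subst (S m q ≤_) (sym (S-elsewhere (suc m) q (λ e → q≢ (trans e (path-down m d)))))
                    (≤-trans (S≤C m q) (proj₁ (C-strips m m<K q)))
    upper : S (suc m) (suc q) ≤ S m q
    upper with q ≟ path m
    ... | yes refl = subst₂ _≤_ (sym S'-here) (sym (S-here m)) (∸-monoˡ-≤ 1 (proj₂ (C-strips m m<K (path m))))
    ... | no q≢ = subst (S (suc m) (suc q) ≤_) (sym (S-elsewhere m q q≢))
                    (≤-trans (S≤C (suc m) (suc q)) (proj₂ (C-strips m m<K q)))
  ... | no nd = lower , upper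
    where
    stay : path (suc m) ≡ path m
    stay = path-stay m (≰⇒> nd)
    lower : S m q ≤ S (suc m) q
    lower = subst (λ z → S m q ≤ C (suc m) q ∸ oneAt z q) (sym stay) (∸-monoˡ-≤ (oneAt (path m) q) (proj₁ (C-strips m m<K q)))
    upper : S (suc m) (suc q) ≤ S m q
    upper with q ≟ path m
    ... | yes refl = subst₂ _≤_ (sym (S-elsewhere (suc m) (suc (path m)) (λ e → 1+n≢n (trans e stay)))) (sym (S-here m))
                       (<⇒≤∸1 (≰⇒> nd))
    ... | no q≢ = subst (S (suc m) (suc q) ≤_) (sym (S-elsewhere m q q≢))
                    (≤-trans (S≤C (suc m) (suc q)) (proj₂ (C-strips m m<K q)))

  S-mono : ∀ r i j → i ≤ j → j ≤ K → S i r ≤ S j r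
  S-mono r = seq-mono (λ m → S m r) K (λ j j<K → proj₁ (S-strips j j<K r))

  -- The tableau while the slide is between levels s − 1 and s.
  Mid : ℕ → ShapeSeq
  Mid s j = if j <ᵇ s then S j else C j

  Mid-below : ∀ s j r → j < s → Mid s j r ≡ S j r
  Mid-below s j r j<s rewrite <ᵇ-true j<s = refl

  Mid-above : ∀ s j r → ¬ (j < s) → Mid s j r ≡ C j r
  Mid-above s j r j≮s rewrite <ᵇ-false j≮s = refl

  Mid-mono : ∀ s r j → j < K → Mid s j r ≤ Mid s (suc j) r
  Mid-mono s r j j<K with suc j <? s | j <? s
  ... | yes j+1<s | _ = subst₂ _≤_ (sym (Mid-below s j r (≤-trans (n≤1+n _) j+1<s))) (sym (Mid-below s (suc j) r j+1<s))
                          (proj₁ (S-strips j j<K r))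
  ... | no j+1≮s | yes j<s = subst₂ _≤_ (sym (Mid-below s j r j<s)) (sym (Mid-above s (suc j) r j+1≮s))
                               (≤-trans (S≤C j r) (proj₁ (C-strips j j<K r)))
  ... | no j+1≮s | no j≮s = subst₂ _≤_ (sym (Mid-above s j r j≮s)) (sym (Mid-above s (suc j) r j+1≮s)) (proj₁ (C-strips j j<K r))

  Mid-suc : ∀ t j r → ¬ (j ≡ suc t × r ≡ path (suc t)) → Mid (suc (suc t)) j r ≡ Mid (suc t) j r
  Mid-suc t j r not-here with j ≟ suc t
  ... | yes refl = trans (Mid-below (suc (suc t)) (suc t) r ≤-refl)
                         (trans (S-elsewhere (suc t) r (λ e → not-here (refl , e))) (sym (Mid-above (suc t) (suc t) r (<-irrefl refl))))
  ... | no j≢ with j <? suc t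
  ...   | yes j<t+1 = trans (Mid-below (suc (suc t)) j r (≤-trans j<t+1 (n≤1+n _))) (sym (Mid-below (suc t) j r j<t+1))
  ...   | no j≮t+1 = trans (Mid-above (suc (suc t)) j r (λ z → j≢ (≤-antisym (≤-pred z) (≮⇒≥ j≮t+1))))
                           (sym (Mid-above (suc t) j r j≮t+1))

  Mid-step-unique : ∀ s r i j c → i < K → j < K → Mid s i r ≤ c → c < Mid s (suc i) r → Mid s j r ≤ c → c < Mid s (suc j) r → i ≡ j
  Mid-step-unique s r = seq-step-unique (λ j → Mid s j r) K (λ j j<K → Mid-mono s r j j<K)

  FillsExceptHole : ℕ → ℕ → ℕ → Filling → Set
  FillsExceptHole s ρ γ f = ∀ j r c → j < K → ¬ (r ≡ ρ × c ≡ γ) → Mid s j r ≤ c → c < Mid s (suc j) r → f r c ≡ suc j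

  SlideResult : ℕ → ℕ → ℕ → Filling → Set
  SlideResult n ρ γ f = Σ Filling (λ f' → (slideF n outer f ρ γ ≡ (f' , path K , C K (path K) ∸ 1)) × Fills K S f')

  finish : ∀ n f → FillsExceptHole (suc K) (path K) (C K (path K) ∸ 1) f → SlideResult n (path K) (C K (path K) ∸ 1) f
  finish n f fills = f , stops n , fills-S
    where
    γ : ℕ
    γ = C K (path K) ∸ 1
    no-right : (suc γ <ᵇ part outer (path K)) ≡ false
    no-right = <ᵇ-false (λ z → <-irrefl refl (subst (_< C K (path K)) (suc[∸1] (path-nonempty K ≤-refl))
                                                (subst (suc γ <_) (outer≡ (path K)) z)))
    no-down : (γ <ᵇ part outer (suc (path K))) ≡ false
    no-down = <ᵇ-false (λ z → <-irrefl refl (<-≤-trans (subst (γ <_) (outer≡ (suc (path K))) z) (<⇒≤∸1 (path-corner K ≤-refl))))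
    stops : ∀ n → slideF n outer f (path K) γ ≡ (f , path K , γ)
    stops zero = refl
    stops (suc n) = SlideFStep.stop n outer f (path K) γ no-right no-down
    fills-S : Fills K S f
    fills-S m r c m<K lower upper =
      fills m r c m<K not-hole (subst (_≤ c) (sym (Mid-below (suc K) m r (≤-trans m<K (n≤1+n K)))) lower)
                               (subst (c <_) (sym (Mid-below (suc K) (suc m) r (s≤s m<K))) upper)
      where
      not-hole : ¬ (r ≡ path K × c ≡ γ)
      not-hole (refl , refl) = <-irrefl refl (<-≤-trans upper (≤-trans (S-mono (path K) (suc m) K m<K ≤-refl) (≤-reflexive (S-here K))))

  finish' : ∀ n f s ρ γ → s ≡ suc K → ρ ≡ path K → γ ≡ C K ρ ∸ 1 → FillsExceptHole s ρ γ f → SlideResult n ρ γ f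
  finish' n f .(suc K) .(path K) .(C K (path K) ∸ 1) refl refl refl = finish n f

  outer-parts : ∀ i → part outer (suc i) ≤ part outer i
  outer-parts i = subst₂ _≤_ (sym (outer≡ (suc i))) (sym (outer≡ i)) (C-parts K ≤-refl i)

  -- The fuel of slideF runs out only beyond the boxes of the outer shape.
  fuel-suffices : ∀ ρ γ r c → sum outer ≤ 0 + ρ + γ → c < C K r → ρ + γ < r + c → ⊥
  fuel-suffices ρ γ r c fuel c<C ρ+γ<r+c =
    1+n≰n (≤-trans (row+col<size outer outer-parts r c (subst (c <_) (sym (outer≡ r)) c<C)) (≤-trans fuel (≤-trans (n≤1+n _) ρ+γ<r+c)))

  entry-from : ∀ t → t < K → ∀ ρ γ f → FillsExceptHole (suc t) ρ γ f → ∀ r c → ¬ (r ≡ ρ × c ≡ γ) → Mid (suc t) t r ≤ c → c < C K r →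
               Σ ℕ (λ j → t ≤ j × j < K × Mid (suc t) j r ≤ c × c < Mid (suc t) (suc j) r × f r c ≡ suc j)
  entry-from t t<K ρ γ f fills r c not-hole lower c<C
    with seq-crossing (λ j → Mid (suc t) j r) c K t (<⇒≤ t<K) lower (subst (c <_) (sym (Mid-above (suc t) K r (λ z → <⇒≱ t<K (≤-pred z)))) c<C)
  ... | (j , t≤j , j<K , lower' , upper') = j , t≤j , j<K , lower' , upper' , fills j r c j<K not-hole lower' upper'

  fills-init : ∀ f → Fills K C f → FillsExceptHole 1 r₀ (C 0 r₀ ∸ 1) f
  fills-init f fills j r c j<K not-hole lower upper with inStrip-removeLast C (Mid 1) 0 r₀ (C 0 r₀ ∸ 1) same here C₀r₀ j r c not-hole lower upper
    where
    same : ∀ j r → ¬ (j ≡ 0 × r ≡ r₀) → Mid 1 j r ≡ C j r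
    same zero r ne = trans (Mid-below 1 0 r (s≤s z≤n)) (S-elsewhere 0 r (λ e → ne (refl , e)))
    same (suc j) r ne = Mid-above 1 (suc j) r (λ { (s≤s ()) })
    here : Mid 1 0 r₀ ≡ C 0 r₀ ∸ 1
    here = trans (Mid-below 1 0 r₀ (s≤s z≤n)) (S-here 0)
    C₀r₀ : C 0 r₀ ≡ suc (C 0 r₀ ∸ 1)
    C₀r₀ = sym (suc[∸1] (path-nonempty 0 z≤n))
  ... | (lower' , upper') = fills j r c j<K lower' upper'

  -- Passing from Mid (t + 1) to Mid (t + 2) removes the last box of row
  -- path (t + 1) of C (t + 1).
  inStrip-levelUp : ∀ t → suc t ≤ K → ∀ γ → γ ≡ C (suc t) (path (suc t)) ∸ 1 →
    ∀ j r c → ¬ (r ≡ path (suc t) × c ≡ γ) → Mid (suc (suc t)) j r ≤ c → c < Mid (suc (suc t)) (suc j) r →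
    Mid (suc t) j r ≤ c × c < Mid (suc t) (suc j) r
  inStrip-levelUp t t<K γ γ≡ = inStrip-removeLast (Mid (suc t)) (Mid (suc (suc t))) (suc t) (path (suc t)) γ (Mid-suc t) new old
    where
    new : Mid (suc (suc t)) (suc t) (path (suc t)) ≡ γ
    new = trans (Mid-below (suc (suc t)) (suc t) (path (suc t)) ≤-refl) (trans (S-here (suc t)) (sym γ≡))
    old : Mid (suc t) (suc t) (path (suc t)) ≡ suc γ
    old = trans (Mid-above (suc t) (suc t) (path (suc t)) (<-irrefl refl))
                (trans (sym (suc[∸1] (path-nonempty (suc t) t<K))) (cong suc (sym γ≡)))

  fills-levelUp : ∀ t → suc t ≤ K → ∀ γ f → γ ≡ C (suc t) (path (suc t)) ∸ 1 → path (suc t) ≡ path t →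
                  FillsExceptHole (suc t) (path t) γ f → FillsExceptHole (suc (suc t)) (path (suc t)) γ f
  fills-levelUp t t<K γ f γ≡ stay fills j r c j<K not-hole lower upper with inStrip-levelUp t t<K γ γ≡ j r c not-hole lower upper
  ... | (lower' , upper') = fills j r c j<K (λ z → not-hole (trans (proj₁ z) (sym stay) , proj₂ z)) lower' upper'

  fills-down : ∀ t → t < K → ∀ γ f → path (suc t) ≡ suc (path t) → γ ≡ C t (path t) ∸ 1 → γ ≡ C (suc t) (suc (path t)) ∸ 1 →
               f (suc (path t)) γ ≡ suc t → γ < C (suc t) (path t) → FillsExceptHole (suc t) (path t) γ f →
               FillsExceptHole (suc (suc t)) (path (suc t)) γ (update f (path t) γ (f (suc (path t)) γ))
  fills-down t t<K γ f down γ≡ γ≡' f-below γ<C fills j r c j<K not-hole lower upper with (r ≟ path t) ×-dec (c ≟ γ)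
  ... | yes (refl , refl) = trans (update-here f (path t) γ _) (trans f-below (cong suc (Mid-step-unique (suc (suc t)) (path t) t j γ t<K j<K lower-t upper-t lower upper)))
    where
    lower-t : Mid (suc (suc t)) t (path t) ≤ γ
    lower-t = ≤-reflexive (trans (Mid-below (suc (suc t)) t (path t) (n≤1+n (suc t))) (trans (S-here t) (sym γ≡)))
    upper-t : γ < Mid (suc (suc t)) (suc t) (path t)
    upper-t = subst (γ <_) (sym (trans (Mid-below (suc (suc t)) (suc t) (path t) ≤-refl) (S-elsewhere (suc t) (path t) (λ e → 1+n≢n (sym (trans e down)))))) γ<C
  ... | no not-old-hole = trans (update-elsewhere f (path t) γ _ r c not-old-hole) (fills j r c j<K not-old-hole (proj₁ inStrip) (proj₂ inStrip))
    where
    inStrip : Mid (suc t) j r ≤ c × c < Mid (suc t) (suc j) r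
    inStrip = inStrip-levelUp t t<K γ (trans γ≡' (cong (λ z → C (suc t) z ∸ 1) (sym down))) j r c not-hole lower upper

  fills-right : ∀ t → t < K → ∀ γ f → C t (path t) ∸ 1 ≤ γ → suc γ < C (suc t) (path t) → f (path t) (suc γ) ≡ suc t →
                FillsExceptHole (suc t) (path t) γ f → FillsExceptHole (suc t) (path t) (suc γ) (update f (path t) γ (f (path t) (suc γ)))
  fills-right t t<K γ f start≤γ γ+1<C f-right fills j r c j<K not-hole lower upper with (r ≟ path t) ×-dec (c ≟ γ)
  ... | yes (refl , refl) = trans (update-here f (path t) γ _) (trans f-right (cong suc (Mid-step-unique (suc t) (path t) t j γ t<K j<K lower-t upper-t lower upper)))
    where
    lower-t : Mid (suc t) t (path t) ≤ γ
    lower-t = subst (_≤ γ) (sym (trans (Mid-below (suc t) t (path t) ≤-refl) (S-here t))) start≤γ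
    upper-t : γ < Mid (suc t) (suc t) (path t)
    upper-t = subst (γ <_) (sym (Mid-above (suc t) (suc t) (path t) (<-irrefl refl))) (≤-trans (n≤1+n _) γ+1<C)
  ... | no not-old-hole = trans (update-elsewhere f (path t) γ _ r c not-old-hole) (fills j r c j<K not-old-hole lower upper)

  -- The empty box at (path t, γ), between levels t and t + 1. It can only
  -- have moved right if the box below its entry point was not in the strip.
  record Hole (t γ : ℕ) (f : Filling) : Set where
    field
      start≤γ : C t (path t) ∸ 1 ≤ γ
      γ<end : γ < C (suc t) (path t)
      moved⇒not-down : C t (path t) ∸ 1 < γ → C (suc t) (suc (path t)) ≤ C t (path t) ∸ 1
      fills : FillsExceptHole (suc t) (path t) γ f

  hole-at-start : ∀ t → t < K → ∀ γ f → γ ≡ C t (path t) ∸ 1 → FillsExceptHole (suc t) (path t) γ f → Hole t γ f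
  hole-at-start t t<K γ f γ≡ fills = record
    { start≤γ = ≤-reflexive (sym γ≡)
    ; γ<end = <-≤-trans (subst (_< C t (path t)) (sym γ≡) (∸1< (path-nonempty t (<⇒≤ t<K)))) (proj₁ (C-strips t t<K (path t)))
    ; moved⇒not-down = λ lt → ⊥-elim (<-irrefl (sym γ≡) lt)
    ; fills = fills }

  module Down (t γ : ℕ) (f : Filling) (t<K : t < K) (hole : Hole t γ f) (d : C t (path t) ≤ C (suc t) (suc (path t))) where
    open Hole hole
    ρ : ℕ
    ρ = path t

    path≡ : path (suc t) ≡ suc ρ
    path≡ = path-down t d

    γ≡start : γ ≡ C t ρ ∸ 1
    γ≡start with C t ρ ∸ 1 <? γ
    ... | yes moved = ⊥-elim (<-irrefl refl (<-≤-trans (≤-<-trans (moved⇒not-down moved) (∸1< (path-nonempty t (<⇒≤ t<K)))) d))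
    ... | no not-moved = ≤-antisym (≮⇒≥ not-moved) start≤γ

    below≡ : C (suc t) (suc ρ) ≡ C t ρ
    below≡ = ≤-antisym (proj₂ (C-strips t t<K ρ)) d

    γ≡' : γ ≡ C (suc t) (path (suc t)) ∸ 1
    γ≡' = trans γ≡start (cong (_∸ 1) (trans (sym below≡) (cong (C (suc t)) (sym path≡))))

    γ<below : γ < C (suc t) (suc ρ)
    γ<below = subst (γ <_) (sym below≡) (subst (_< C t ρ) (sym γ≡start) (∸1< (path-nonempty t (<⇒≤ t<K))))

    γ<C-below : γ < C K (suc ρ)
    γ<C-below = <-≤-trans γ<below (C-mono (suc ρ) (suc t) K t<K ≤-refl)

    f-below : f (suc ρ) γ ≡ suc t
    f-below = fills t (suc ρ) γ t<K (λ z → 1+n≢n (proj₁ z)) lower upper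
      where
      lower : Mid (suc t) t (suc ρ) ≤ γ
      lower = subst (_≤ γ) (sym (trans (Mid-below (suc t) t (suc ρ) ≤-refl) (S-below-path t)))
                    (subst (C t (suc ρ) ≤_) (sym γ≡start) (<⇒≤∸1 (path-corner t (<⇒≤ t<K))))
      upper : γ < Mid (suc t) (suc t) (suc ρ)
      upper = subst (γ <_) (sym (Mid-above (suc t) (suc t) (suc ρ) (<-irrefl refl))) γ<below

    f' : Filling
    f' = update f ρ γ (f (suc ρ) γ)

    fills' : FillsExceptHole (suc (suc t)) (path (suc t)) γ f'
    fills' = fills-down t t<K γ f path≡ γ≡start (trans γ≡' (cong (λ z → C (suc t) z ∸ 1) path≡)) f-below γ<end fills

    -- The entry right of the hole is at least t + 1, so it does not win.
    slideF≡ : ∀ n → slideF (suc n) outer f ρ γ ≡ slideF n outer f' (path (suc t)) γ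
    slideF≡ n = trans moves-down (cong (λ z → slideF n outer f' z γ) (sym path≡))
      where
      open SlideFStep n outer f ρ γ
      down-ok : (γ <ᵇ part outer (suc ρ)) ≡ true
      down-ok = <ᵇ-true (subst (γ <_) (sym (outer≡ (suc ρ))) γ<C-below)
      moves-down : slideF (suc n) outer f ρ γ ≡ down
      moves-down with suc γ <? C K ρ
      ... | yes right-exists = down-not-smaller (<ᵇ-true (subst (suc γ <_) (sym (outer≡ ρ)) right-exists)) down-ok (<ᵇ-false right≮below)
        where
        right≮below : ¬ (f ρ (suc γ) < f (suc ρ) γ)
        right≮below z with entry-from t t<K ρ γ f fills ρ (suc γ) (λ w → 1+n≢n (proj₂ w))
                             (subst (_≤ suc γ) (sym (trans (Mid-below (suc t) t ρ ≤-refl) (S-here t))) (≤-trans start≤γ (n≤1+n γ))) right-exists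
        ... | (j , t≤j , _ , _ , _ , f-right) = <-irrefl refl (≤-trans (subst₂ _<_ f-right f-below z) (s≤s t≤j))
      ... | no no-right = down-only (<ᵇ-false (λ z → no-right (subst (suc γ <_) (outer≡ ρ) z))) down-ok

  module Right (t γ : ℕ) (f : Filling) (t<K : t < K) (hole : Hole t γ f)
               (nd : C (suc t) (suc (path t)) < C t (path t)) (right-in : suc γ < C (suc t) (path t)) where
    open Hole hole
    ρ : ℕ
    ρ = path t

    right<C : suc γ < C K ρ
    right<C = <-≤-trans right-in (C-mono ρ (suc t) K t<K ≤-refl)

    f-right : f ρ (suc γ) ≡ suc t
    f-right = fills t ρ (suc γ) t<K (λ z → 1+n≢n (proj₂ z)) lower upper
      where
      lower : Mid (suc t) t ρ ≤ suc γ
      lower = subst (_≤ suc γ) (sym (trans (Mid-below (suc t) t ρ ≤-refl) (S-here t))) (≤-trans start≤γ (n≤1+n γ))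
      upper : suc γ < Mid (suc t) (suc t) ρ
      upper = subst (suc γ <_) (sym (Mid-above (suc t) (suc t) ρ (<-irrefl refl))) right-in

    f' : Filling
    f' = update f ρ γ (f ρ (suc γ))

    hole' : Hole t (suc γ) f'
    hole' = record
      { start≤γ = ≤-trans start≤γ (n≤1+n γ)
      ; γ<end = right-in
      ; moved⇒not-down = λ _ → <⇒≤∸1 nd
      ; fills = fills-right t t<K γ f start≤γ right-in f-right fills }

    -- The entry below the hole, if any, lies beyond the strip of level t + 1.
    slideF≡ : ∀ n → slideF (suc n) outer f ρ γ ≡ slideF n outer f' ρ (suc γ)
    slideF≡ n with γ <? C K (suc ρ)
    ... | yes below-exists = SlideFStep.right-smaller n outer f ρ γ right-ok (<ᵇ-true (subst (γ <_) (sym (outer≡ (suc ρ))) below-exists)) (<ᵇ-true right<below)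
      where
      right-ok : (suc γ <ᵇ part outer ρ) ≡ true
      right-ok = <ᵇ-true (subst (suc γ <_) (sym (outer≡ ρ)) right<C)
      right<below : f ρ (suc γ) < f (suc ρ) γ
      right<below with entry-from t t<K ρ γ f fills (suc ρ) γ (λ w → 1+n≢n (proj₁ w))
                         (subst (_≤ γ) (sym (trans (Mid-below (suc t) t (suc ρ) ≤-refl) (S-below-path t))) (≤-trans (<⇒≤∸1 (path-corner t (<⇒≤ t<K))) start≤γ))
                         below-exists
      ... | (j , t≤j , _ , _ , upper , f-below) with t ≟ j
      ...   | yes refl = ⊥-elim (<-irrefl refl (<-≤-trans (subst (γ <_) (Mid-above (suc t) (suc t) (suc ρ) (<-irrefl refl)) upper) (≤-trans (<⇒≤∸1 nd) start≤γ)))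
      ...   | no t≢j = subst₂ _<_ (sym f-right) (sym f-below) (s≤s (≤∧≢⇒< t≤j t≢j))
    ... | no no-below = SlideFStep.right-only n outer f ρ γ (<ᵇ-true (subst (suc γ <_) (sym (outer≡ ρ)) right<C))
                          (<ᵇ-false (λ z → no-below (subst (γ <_) (outer≡ (suc ρ)) z)))

  module LevelUp (t γ : ℕ) (f : Filling) (t<K : t < K) (hole : Hole t γ f)
                 (nd : C (suc t) (suc (path t)) < C t (path t)) (no-right : ¬ (suc γ < C (suc t) (path t))) where
    open Hole hole

    path≡ : path (suc t) ≡ path t
    path≡ = path-stay t nd

    γ≡' : γ ≡ C (suc t) (path (suc t)) ∸ 1
    γ≡' = sym (trans (cong (λ z → C (suc t) z ∸ 1) path≡) (cong (_∸ 1) (≤-antisym (≮⇒≥ no-right) γ<end)))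

    fills' : FillsExceptHole (suc (suc t)) (path (suc t)) γ f
    fills' = fills-levelUp t t<K γ f γ≡' path≡ fills

  via : ∀ n ρ γ f n' ρ' γ' f' → slideF n outer f ρ γ ≡ slideF n' outer f' ρ' γ' → SlideResult n' ρ' γ' f' → SlideResult n ρ γ f
  via n ρ γ f n' ρ' γ' f' e (f'' , e' , fills) = f'' , trans e e' , fills

  <K : ∀ u t → suc u + t ≡ K → t < K
  <K u t eK = subst (t <_) eK (s≤s (m≤n+m t u))

  -- u counts the levels still to be passed.
  mutual
    fromStart : ∀ n u t γ f → u + t ≡ K → γ ≡ C t (path t) ∸ 1 → FillsExceptHole (suc t) (path t) γ f →
                sum outer ≤ n + path t + γ → SlideResult n (path t) γ f
    fromStart n zero t γ f eK γ≡ fills fuel =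
      finish' n f (suc t) (path t) γ (cong suc eK) (cong path eK) (trans γ≡ (cong (λ z → C z (path t) ∸ 1) eK)) fills
    fromStart n (suc u) t γ f eK γ≡ fills fuel = run n u t γ f eK (hole-at-start t (<K u t eK) γ f γ≡ fills) fuel

    run : ∀ n u t γ f → suc u + t ≡ K → Hole t γ f → sum outer ≤ n + path t + γ → SlideResult n (path t) γ f
    run n u t γ f eK hole fuel with C t (path t) ≤? C (suc t) (suc (path t))
    ... | yes d = runDown n u t γ f eK hole fuel d
    ... | no nd with suc γ <? C (suc t) (path t)
    ...   | yes right-in = runRight n u t γ f eK hole fuel (≰⇒> nd) right-in
    ...   | no no-right = runLevelUp n u t γ f eK hole fuel (≰⇒> nd) no-right

    runDown : ∀ n u t γ f → suc u + t ≡ K → Hole t γ f → sum outer ≤ n + path t + γ →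
              C t (path t) ≤ C (suc t) (suc (path t)) → SlideResult n (path t) γ f
    runDown zero u t γ f eK hole fuel d = ⊥-elim (fuel-suffices (path t) γ (suc (path t)) γ fuel D.γ<C-below ≤-refl)
      where module D = Down t γ f (<K u t eK) hole d
    runDown (suc n) u t γ f eK hole fuel d =
      via (suc n) (path t) γ f n (path (suc t)) γ D.f' (D.slideF≡ n) (fromStart n u (suc t) γ D.f' (trans (+-suc u t) eK) D.γ≡' D.fills'
                                   (subst (λ z → sum outer ≤ n + z + γ) (sym D.path≡) (subst (λ z → sum outer ≤ z + γ) (sym (+-suc n (path t))) fuel)))
      where module D = Down t γ f (<K u t eK) hole d

    runRight : ∀ n u t γ f → suc u + t ≡ K → Hole t γ f → sum outer ≤ n + path t + γ →
               C (suc t) (suc (path t)) < C t (path t) → suc γ < C (suc t) (path t) → SlideResult n (path t) γ f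
    runRight zero u t γ f eK hole fuel nd right-in =
      ⊥-elim (fuel-suffices (path t) γ (path t) (suc γ) fuel R.right<C (≤-reflexive (sym (+-suc (path t) γ))))
      where module R = Right t γ f (<K u t eK) hole nd right-in
    runRight (suc n) u t γ f eK hole fuel nd right-in =
      via (suc n) (path t) γ f n (path t) (suc γ) R.f' (R.slideF≡ n) (run n u t (suc γ) R.f' eK R.hole' (subst (sum outer ≤_) (sym (+-suc (n + path t) γ)) fuel))
      where module R = Right t γ f (<K u t eK) hole nd right-in

    runLevelUp : ∀ n u t γ f → suc u + t ≡ K → Hole t γ f → sum outer ≤ n + path t + γ →
                 C (suc t) (suc (path t)) < C t (path t) → ¬ (suc γ < C (suc t) (path t)) → SlideResult n (path t) γ f
    runLevelUp n u t γ f eK hole fuel nd no-right =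
      subst (λ z → SlideResult n z γ f) L.path≡
        (fromStart n u (suc t) γ f (trans (+-suc u t) eK) L.γ≡' L.fills' (subst (λ z → sum outer ≤ n + z + γ) (sym L.path≡) fuel))
      where module L = LevelUp t γ f (<K u t eK) hole nd no-right

  slide-correct : ∀ f → Fills K C f → SlideResult (suc (sum outer)) r₀ (C 0 r₀ ∸ 1) f
  slide-correct f fills = fromStart (suc (sum outer)) K 0 (C 0 r₀ ∸ 1) f (+-identityʳ K) refl (fills-init f fills)
                            (≤-trans (n≤1+n _) (≤-trans (m≤m+n (suc (sum outer)) r₀) (m≤m+n _ _)))

-- The jeu de taquin loop

IsTableauSeq : ℕ → ShapeSeq → Set
IsTableauSeq K C = (∀ m → m ≤ K → ∀ q → C m (suc q) ≤ C m q) × (∀ m → m < K → IsHStrip (C m) (C (suc m)))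

Represents : ℕ → ShapeSeq → JState → Set
Represents K C s = Fills K C (proj₁ s) × (∀ r → part (proj₁ (proj₂ s)) r ≡ C K r) × IsTableauSeq K C

Represents-cong : ∀ K {C C'} (s : JState) → (∀ m q → C m q ≡ C' m q) → Represents K C s → Represents K C' s
Represents-cong K {C} {C'} s e (fills , outer≡ , C-parts , C-strips) =
  (λ m r c m<K lower upper → fills m r c m<K (subst (_≤ c) (sym (e m r)) lower) (subst (c <_) (sym (e (suc m) r)) upper)) ,
  (λ r → trans (outer≡ r) (e K r)) ,
  (λ m m≤K q → subst₂ _≤_ (e m (suc q)) (e m q) (C-parts m m≤K q)) ,
  (λ m m<K q → subst₂ _≤_ (e m q) (e (suc m) q) (proj₁ (C-strips m m<K q)) , subst₂ _≤_ (e (suc m) (suc q)) (e m q) (proj₂ (C-strips m m<K q)))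

jstep-slide : ∀ K C f outer vac r₀ e → Represents K C (f , outer , vac) → C 0 (suc r₀) < C 0 r₀ →
  Σ Filling λ f' →
    (jstep (f , outer , vac) ((r₀ , C 0 r₀ ∸ 1) , e)
       ≡ (f' , decRow outer (slidePath C r₀ K) , ((slidePath C r₀ K , C K (slidePath C r₀ K) ∸ 1 , e) ∷ vac)))
    × Represents K (afterSlide C r₀) (f' , decRow outer (slidePath C r₀ K) , ((slidePath C r₀ K , C K (slidePath C r₀ K) ∸ 1 , e) ∷ vac))
jstep-slide K C f outer vac r₀ e (fills , outer≡ , C-parts , C-strips) corner =
  f' , jstep≡ , fills' , outer≡' , O.S-parts , O.S-strips
  where
  module O = OneSlide K C r₀ outer C-parts C-strips outer≡ corner
  result : O.SlideResult (suc (sum outer)) r₀ (C 0 r₀ ∸ 1) f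
  result = O.slide-correct f fills
  f' : Filling
  f' = proj₁ result
  fills' : Fills K O.S f'
  fills' = proj₂ (proj₂ result)
  jstep≡ : jstep (f , outer , vac) ((r₀ , C 0 r₀ ∸ 1) , e)
         ≡ (f' , decRow outer (O.path K) , ((O.path K , C K (O.path K) ∸ 1 , e) ∷ vac))
  jstep≡ rewrite proj₁ (proj₂ result) = refl
  outer≡' : ∀ r → part (decRow outer (O.path K)) r ≡ O.S K r
  outer≡' r = trans (part-decRow outer (O.path K) r) (cong (_∸ oneAt (O.path K) r) (outer≡ r))

cornerBoxes : Shape → List ℕ → List (ℕ × ℕ)
cornerBoxes g [] = []
cornerBoxes g (ρ ∷ ρs) = (ρ , g ρ ∸ 1) ∷ cornerBoxes (removeBox g ρ) ρs

AreCorners : Shape → List ℕ → Set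
AreCorners g [] = ⊤
AreCorners g (ρ ∷ ρs) = (g (suc ρ) < g ρ) × AreCorners (removeBox g ρ) ρs

vacatedCount : ℕ → ℕ → List (ℕ × ℕ × ℕ) → ℕ
vacatedCount r t = countᵇ (λ v → (proj₁ v ≡ᵇ r) ∧ (proj₂ (proj₂ v) ≤ᵇ t))

keepIf : Bool → ℕ → ℕ
keepIf b x = if b then x else 0

keepIf-zero : ∀ b → keepIf b 0 ≡ 0
keepIf-zero true = refl
keepIf-zero false = refl

keepIf-+ : ∀ b x y → keepIf b (x + y) ≡ keepIf b x + keepIf b y
keepIf-+ true x y = refl
keepIf-+ false x y = refl

vacatedCount-∷ : ∀ r t a b e vac → vacatedCount r t ((a , b , e) ∷ vac) ≡ keepIf (e ≤ᵇ t) (oneAt a r) + vacatedCount r t vac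
vacatedCount-∷ r t a b e vac with a ≟ r
... | yes refl rewrite ≡ᵇ-refl a with e ≤ᵇ t
...   | true = refl
...   | false = refl
vacatedCount-∷ r t a b e vac | no a≢r rewrite ≡ᵇ-false a≢r | ≡ᵇ-false (λ z → a≢r (sym z)) with e ≤ᵇ t
...   | true = refl
...   | false = refl

withEntry : ℕ → List (ℕ × ℕ) → List ((ℕ × ℕ) × ℕ)
withEntry e = map (λ b → b , e)

vacated : JState → List (ℕ × ℕ × ℕ)
vacated s = proj₂ (proj₂ s)

Outcome : ℕ → ShapeSeq → JState → JState → (ℕ → ℕ → ℕ) → Set
Outcome K C s s' v = Represents K C s' × (∀ r t → vacatedCount r t (vacated s') ≡ v r t + vacatedCount r t (vacated s))

jstep-slides : ∀ K e ρs C (s : JState) → Represents K C s → AreCorners (C 0) ρs →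
  Outcome K (afterSlides C ρs) s (foldl jstep s (withEntry e (cornerBoxes (C 0) ρs))) (λ r t → keepIf (e ≤ᵇ t) (occurrences r (slidePaths C ρs K)))
jstep-slides K e [] C s rep corners = rep , (λ r t → sym (cong (_+ vacatedCount r t (vacated s)) (keepIf-zero (e ≤ᵇ t))))
jstep-slides K e (ρ ∷ ρs) C (f , outer , vac) rep (corner , corners) with jstep-slide K C f outer vac ρ e rep corner
... | f' , jstep≡ , rep' rewrite jstep≡ = proj₁ IH , counts
  where
  p : ℕ
  p = slidePath C ρ K
  s₁ : JState
  s₁ = (f' , decRow outer p , ((p , C K p ∸ 1 , e) ∷ vac))
  IH : Outcome K (afterSlides (afterSlide C ρ) ρs) s₁ (foldl jstep s₁ (withEntry e (cornerBoxes (removeBox (C 0) ρ) ρs)))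
               (λ r t → keepIf (e ≤ᵇ t) (occurrences r (slidePaths (afterSlide C ρ) ρs K)))
  IH = jstep-slides K e ρs (afterSlide C ρ) s₁ rep' corners
  counts : ∀ r t → vacatedCount r t (vacated (foldl jstep s₁ (withEntry e (cornerBoxes (removeBox (C 0) ρ) ρs))))
                   ≡ keepIf (e ≤ᵇ t) (occurrences r (slidePaths C (ρ ∷ ρs) K)) + vacatedCount r t vac
  counts r t = begin
      vacatedCount r t (vacated (foldl jstep s₁ (withEntry e (cornerBoxes (removeBox (C 0) ρ) ρs))))
    ≡⟨ proj₂ IH r t ⟩
      rest + vacatedCount r t ((p , C K p ∸ 1 , e) ∷ vac)
    ≡⟨ cong (rest +_) (vacatedCount-∷ r t p _ e vac) ⟩
      rest + (keepIf (e ≤ᵇ t) (oneAt p r) + vacatedCount r t vac)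
    ≡⟨ +-assoc rest _ _ ⟨
      (rest + keepIf (e ≤ᵇ t) (oneAt p r)) + vacatedCount r t vac
    ≡⟨ cong (_+ vacatedCount r t vac) (trans (+-comm rest _) (sym (keepIf-+ (e ≤ᵇ t) (oneAt p r) _))) ⟩
      keepIf (e ≤ᵇ t) (occurrences r (slidePaths C (ρ ∷ ρs) K)) + vacatedCount r t vac
    ∎
    where
    open ≡-Reasoning
    rest : ℕ
    rest = keepIf (e ≤ᵇ t) (occurrences r (slidePaths (afterSlide C ρ) ρs K))

rowSegment : ℕ → ℕ → ℕ → List (ℕ × ℕ)
rowSegment r hi zero = []
rowSegment r hi (suc n) = (r , hi ∸ 1) ∷ rowSegment r (hi ∸ 1) n

stripBoxesFrom : Shape → Shape → ℕ → ℕ → List (ℕ × ℕ)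
stripBoxesFrom β α ρ zero = []
stripBoxesFrom β α ρ (suc t) = rowSegment ρ (β ρ) (β ρ ∸ α ρ) ++ stripBoxesFrom β α (suc ρ) t

cornerBoxes-cong : ∀ ρs {g h} → (∀ r → g r ≡ h r) → cornerBoxes g ρs ≡ cornerBoxes h ρs
cornerBoxes-cong [] e = refl
cornerBoxes-cong (ρ ∷ ρs) e = cong₂ _∷_ (cong (λ z → ρ , z ∸ 1) (e ρ)) (cornerBoxes-cong ρs (removeBox-cong e ρ))

cornerBoxes-replicate : ∀ n ρ g ρs → cornerBoxes g (replicate n ρ ++ ρs) ≡ rowSegment ρ (g ρ) n ++ cornerBoxes (removeBoxes g ρ n) ρs
cornerBoxes-replicate zero ρ g ρs = cornerBoxes-cong ρs (λ r → sym (removeBoxes-zero g ρ r))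
cornerBoxes-replicate (suc n) ρ g ρs = cong ((ρ , g ρ ∸ 1) ∷_)
  (trans (cornerBoxes-replicate n ρ (removeBox g ρ) ρs)
         (cong₂ _++_ (cong (λ z → rowSegment ρ z n) (removeBox-here g ρ)) (cornerBoxes-cong ρs (removeBoxes-removeBox g ρ n))))

removeBoxes-above : ∀ {g β : Shape} {ρ} → (∀ q → ρ ≤ q → g q ≡ β q) → ∀ n q → suc ρ ≤ q → removeBoxes g ρ n q ≡ β q
removeBoxes-above {g} {β} {ρ} g≡β n q ρ<q = trans (removeBoxes-elsewhere g ρ n q (λ z → 1+n≰n (subst (suc ρ ≤_) z ρ<q))) (g≡β q (≤-trans (n≤1+n ρ) ρ<q))

cornerBoxes-stripRows : ∀ (β α : Shape) t ρ g → (∀ q → ρ ≤ q → g q ≡ β q) →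
  cornerBoxes g (stripRows (λ q → β q ∸ α q) ρ t) ≡ stripBoxesFrom β α ρ t
cornerBoxes-stripRows β α zero ρ g g≡β = refl
cornerBoxes-stripRows β α (suc t) ρ g g≡β =
  trans (cornerBoxes-replicate (β ρ ∸ α ρ) ρ g _)
        (cong₂ _++_ (cong (λ z → rowSegment ρ z (β ρ ∸ α ρ)) (g≡β ρ ≤-refl))
                    (cornerBoxes-stripRows β α t (suc ρ) (removeBoxes g ρ (β ρ ∸ α ρ)) (removeBoxes-above g≡β (β ρ ∸ α ρ))))

AreCorners-cong : ∀ ρs {g h} → (∀ r → g r ≡ h r) → AreCorners g ρs → AreCorners h ρs
AreCorners-cong [] e corners = tt
AreCorners-cong (ρ ∷ ρs) e (corner , corners) = subst₂ _<_ (e (suc ρ)) (e ρ) corner , AreCorners-cong ρs (removeBox-cong e ρ) corners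

AreCorners-replicate : ∀ n ρ g ρs → g (suc ρ) + n ≤ g ρ → AreCorners (removeBoxes g ρ n) ρs → AreCorners g (replicate n ρ ++ ρs)
AreCorners-replicate zero ρ g ρs room corners = AreCorners-cong ρs (removeBoxes-zero g ρ) corners
AreCorners-replicate (suc n) ρ g ρs room corners =
  corner , AreCorners-replicate n ρ (removeBox g ρ) ρs room' (AreCorners-cong ρs (λ r → sym (removeBoxes-removeBox g ρ n r)) corners)
  where
  room+1 : suc (g (suc ρ) + n) ≤ g ρ
  room+1 = subst (_≤ g ρ) (+-suc (g (suc ρ)) n) room
  corner : g (suc ρ) < g ρ
  corner = ≤-trans (s≤s (m≤m+n (g (suc ρ)) n)) room+1
  room' : removeBox g ρ (suc ρ) + n ≤ removeBox g ρ ρ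
  room' = subst₂ _≤_ (cong (_+ n) (sym (removeBox-elsewhere g ρ (suc ρ) 1+n≢n))) (sym (removeBox-here g ρ)) (<⇒≤∸1 room+1)

AreCorners-stripRows : ∀ (β α : Shape) → IsHStrip α β → ∀ t ρ g → (∀ q → ρ ≤ q → g q ≡ β q) →
  AreCorners g (stripRows (λ q → β q ∸ α q) ρ t)
AreCorners-stripRows β α α⊆β zero ρ g g≡β = tt
AreCorners-stripRows β α α⊆β (suc t) ρ g g≡β =
  AreCorners-replicate (β ρ ∸ α ρ) ρ g _ room
    (AreCorners-stripRows β α α⊆β t (suc ρ) (removeBoxes g ρ (β ρ ∸ α ρ)) (removeBoxes-above g≡β (β ρ ∸ α ρ)))
  where
  room : g (suc ρ) + (β ρ ∸ α ρ) ≤ g ρ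
  room = subst₂ (λ a b → a + (β ρ ∸ α ρ) ≤ b) (sym (g≡β (suc ρ) (n≤1+n ρ))) (sym (g≡β ρ ≤-refl))
           (≤-trans (+-monoˡ-≤ (β ρ ∸ α ρ) (proj₂ (α⊆β ρ))) (≤-reflexive (m+[n∸m]≡n (proj₁ (α⊆β ρ)))))

downFromPrefix : ℕ → ℕ → List ℕ
downFromPrefix hi zero = []
downFromPrefix hi (suc n) = (hi ∸ 1) ∷ downFromPrefix (hi ∸ 1) n

downFrom-split : ∀ n hi → n ≤ hi → downFrom hi ≡ downFromPrefix hi n ++ downFrom (hi ∸ n)
downFrom-split zero hi _ = refl
downFrom-split (suc n) (suc hi) (s≤s n≤hi) = cong (hi ∷_) (downFrom-split n hi n≤hi)

concatMap-downFromPrefix-row : ∀ (g : ℕ → List (ℕ × ℕ)) ρ n hi → n ≤ hi → (∀ c → hi ∸ n ≤ c → c < hi → g c ≡ (ρ , c) ∷ []) →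
  concatMap g (downFromPrefix hi n) ≡ rowSegment ρ hi n
concatMap-downFromPrefix-row g ρ zero hi _ _ = refl
concatMap-downFromPrefix-row g ρ (suc n) (suc hi) (s≤s n≤hi) single =
  trans (cong (_++ concatMap g (downFromPrefix hi n)) (single hi (m∸n≤m hi n) ≤-refl))
        (cong ((ρ , hi) ∷_) (concatMap-downFromPrefix-row g ρ n hi n≤hi (λ c lo c<hi → single c lo (≤-trans c<hi (n≤1+n hi)))))

concatMap-downFromPrefix-empty : ∀ (g : ℕ → List (ℕ × ℕ)) n hi → n ≤ hi → (∀ c → hi ∸ n ≤ c → c < hi → g c ≡ []) →
  concatMap g (downFromPrefix hi n) ≡ []
concatMap-downFromPrefix-empty g zero hi _ _ = refl
concatMap-downFromPrefix-empty g (suc n) (suc hi) (s≤s n≤hi) empty =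
  trans (cong (_++ concatMap g (downFromPrefix hi n)) (empty hi (m∸n≤m hi n) ≤-refl))
        (concatMap-downFromPrefix-empty g n hi n≤hi (λ c lo c<hi → empty c lo (≤-trans c<hi (n≤1+n hi))))

≢true⇒≡false : ∀ {b} → ¬ (b ≡ true) → b ≡ false
≢true⇒≡false {false} _ = refl
≢true⇒≡false {true} h = ⊥-elim (h refl)

filterᵇ-none : ∀ (p : ℕ → Bool) L (f : ℕ → ℕ) → (∀ i → i < L → p (f i) ≡ false) → filterᵇ p (applyUpTo f L) ≡ []
filterᵇ-none p zero f h = refl
filterᵇ-none p (suc L) f h rewrite h 0 (s≤s z≤n) = filterᵇ-none p L (λ i → f (suc i)) (λ i i<L → h (suc i) (s≤s i<L))

filterᵇ-unique : ∀ (p : ℕ → Bool) L (f : ℕ → ℕ) i₀ → i₀ < L → p (f i₀) ≡ true → (∀ i → i < L → p (f i) ≡ true → i ≡ i₀) →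
                 filterᵇ p (applyUpTo f L) ≡ f i₀ ∷ []
filterᵇ-unique p (suc L) f zero _ pi₀ unique rewrite pi₀ =
  cong (f 0 ∷_) (filterᵇ-none p L (λ i → f (suc i)) (λ i i<L → ≢true⇒≡false (λ z → 1+n≢0 (unique (suc i) (s≤s i<L) z))))
filterᵇ-unique p (suc L) f (suc i₀) (s≤s i₀<L) pi₀ unique rewrite ≢true⇒≡false {p (f 0)} (λ z → 1+n≢0 (sym (unique 0 (s≤s z≤n) z))) =
  filterᵇ-unique p L (λ i → f (suc i)) i₀ i₀<L pi₀ (λ i i<L z → suc-injective (unique (suc i) (s≤s i<L) z))

part>0⇒<length : ∀ (λs : Partition) r → 0 < part λs r → r < length λs
part>0⇒<length (x ∷ xs) zero _ = s≤s z≤n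
part>0⇒<length (x ∷ xs) (suc r) h = s≤s (part>0⇒<length xs r h)

length≤⇒part≡0 : ∀ (λs : Partition) r → length λs ≤ r → part λs r ≡ 0
length≤⇒part≡0 [] r _ = refl
length≤⇒part≡0 (x ∷ xs) (suc r) (s≤s h) = length≤⇒part≡0 xs r h

-- stripBoxes reads β/α column by column from the right; since β/α is a
-- horizontal strip, the columns come in runs of single boxes of one row
-- separated by empty columns.
module StripBoxes (α β : Partition) (β-parts : ∀ q → part β (suc q) ≤ part β q) (α⊆β : IsHStrip (part α) (part β)) where
  a b : Shape
  a = part α
  b = part β

  inStripAt : ℕ → ℕ → Bool
  inStripAt c r = (a r ≤ᵇ c) ∧ (c <ᵇ b r)

  column : ℕ → List (ℕ × ℕ)
  column c = map (λ r → r , c) (filterᵇ (inStripAt c) (upTo (length β)))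

  inStripAt-true : ∀ c r → a r ≤ c → c < b r → inStripAt c r ≡ true
  inStripAt-true c r a≤c c<b rewrite ≤ᵇ-true a≤c | <ᵇ-true c<b = refl

  inStripAt-sound : ∀ c r → inStripAt c r ≡ true → a r ≤ c × c < b r
  inStripAt-sound c r e with a r ≤? c | c <? b r
  ... | yes a≤c | yes c<b = a≤c , c<b
  ... | yes a≤c | no c≮b rewrite ≤ᵇ-true a≤c | <ᵇ-false c≮b = ⊥-elim (false≢true e)
    where
    false≢true : false ≡ true → ⊥
    false≢true ()
  ... | no a≰c | _ rewrite ≤ᵇ-false a≰c = ⊥-elim (false≢true e)
    where
    false≢true : false ≡ true → ⊥
    false≢true ()

  a-parts : ∀ q → a (suc q) ≤ a q
  a-parts q = ≤-trans (proj₁ (α⊆β (suc q))) (proj₂ (α⊆β q))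

  column-single : ∀ ρ c → a ρ ≤ c → c < b ρ → column c ≡ (ρ , c) ∷ []
  column-single ρ c a≤c c<b =
    cong (map (λ r → r , c)) (filterᵇ-unique (inStripAt c) (length β) (λ i → i) ρ (part>0⇒<length β ρ (≤-<-trans z≤n c<b)) (inStripAt-true c ρ a≤c c<b) unique)
    where
    unique : ∀ i → i < length β → inStripAt c i ≡ true → i ≡ ρ
    unique i _ e with inStripAt-sound c i e | <-cmp i ρ
    ... | (a≤c' , _) | tri< i<ρ _ _ = ⊥-elim (<-irrefl refl (<-≤-trans c<b (≤-trans (seq-antitone b β-parts (suc i) ρ i<ρ) (≤-trans (proj₂ (α⊆β i)) a≤c'))))
    ... | _ | tri≈ _ i≡ρ _ = i≡ρ
    ... | (_ , c<b') | tri> _ _ ρ<i = ⊥-elim (<-irrefl refl (<-≤-trans c<b' (≤-trans (seq-antitone b β-parts (suc ρ) i ρ<i) (≤-trans (proj₂ (α⊆β ρ)) a≤c))))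

  column-empty : ∀ ρ c → b (suc ρ) ≤ c → c < a ρ → column c ≡ []
  column-empty ρ c b≤c c<a = cong (map (λ r → r , c)) (filterᵇ-none (inStripAt c) (length β) (λ i → i) (λ i _ → ≢true⇒≡false (not-in i)))
    where
    not-in : ∀ i → ¬ (inStripAt c i ≡ true)
    not-in i e with inStripAt-sound c i e | i ≤? ρ
    ... | (a≤c , _) | yes i≤ρ = <-irrefl refl (<-≤-trans c<a (≤-trans (seq-antitone a a-parts i ρ i≤ρ) a≤c))
    ... | (_ , c<b) | no i≰ρ = <-irrefl refl (<-≤-trans c<b (≤-trans (seq-antitone b β-parts (suc ρ) i (≰⇒> i≰ρ)) b≤c))

  concatMap-columns : ∀ t ρ → b (t + ρ) ≡ 0 → concatMap column (downFrom (b ρ)) ≡ stripBoxesFrom b a ρ t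
  concatMap-columns zero ρ h rewrite h = refl
  concatMap-columns (suc t) ρ h = begin
      concatMap column (downFrom (b ρ))
    ≡⟨ cong (concatMap column) (downFrom-split (b ρ ∸ a ρ) (b ρ) (m∸n≤m (b ρ) (a ρ))) ⟩
      concatMap column (downFromPrefix (b ρ) (b ρ ∸ a ρ) ++ downFrom (b ρ ∸ (b ρ ∸ a ρ)))
    ≡⟨ concatMap-++ column (downFromPrefix (b ρ) (b ρ ∸ a ρ)) _ ⟩
      concatMap column (downFromPrefix (b ρ) (b ρ ∸ a ρ)) ++ concatMap column (downFrom (b ρ ∸ (b ρ ∸ a ρ)))
    ≡⟨ cong₂ _++_ (concatMap-downFromPrefix-row column ρ (b ρ ∸ a ρ) (b ρ) (m∸n≤m (b ρ) (a ρ))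
                     (λ c lo hi → column-single ρ c (subst (_≤ c) b∸[b∸a]≡a lo) hi))
                  (cong (λ z → concatMap column (downFrom z)) b∸[b∸a]≡a) ⟩
      rowSegment ρ (b ρ) (b ρ ∸ a ρ) ++ concatMap column (downFrom (a ρ))
    ≡⟨ cong (rowSegment ρ (b ρ) (b ρ ∸ a ρ) ++_) gap ⟩
      rowSegment ρ (b ρ) (b ρ ∸ a ρ) ++ stripBoxesFrom b a (suc ρ) t
    ∎
    where
    open ≡-Reasoning
    b∸[b∸a]≡a : b ρ ∸ (b ρ ∸ a ρ) ≡ a ρ
    b∸[b∸a]≡a = m∸[m∸n]≡n (proj₁ (α⊆β ρ))
    a∸[a∸b']≡b' : a ρ ∸ (a ρ ∸ b (suc ρ)) ≡ b (suc ρ)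
    a∸[a∸b']≡b' = m∸[m∸n]≡n (proj₂ (α⊆β ρ))
    gap : concatMap column (downFrom (a ρ)) ≡ stripBoxesFrom b a (suc ρ) t
    gap = begin
        concatMap column (downFrom (a ρ))
      ≡⟨ cong (concatMap column) (downFrom-split (a ρ ∸ b (suc ρ)) (a ρ) (m∸n≤m (a ρ) (b (suc ρ)))) ⟩
        concatMap column (downFromPrefix (a ρ) (a ρ ∸ b (suc ρ)) ++ downFrom (a ρ ∸ (a ρ ∸ b (suc ρ))))
      ≡⟨ concatMap-++ column (downFromPrefix (a ρ) (a ρ ∸ b (suc ρ))) _ ⟩
        concatMap column (downFromPrefix (a ρ) (a ρ ∸ b (suc ρ))) ++ concatMap column (downFrom (a ρ ∸ (a ρ ∸ b (suc ρ))))
      ≡⟨ cong₂ _++_ (concatMap-downFromPrefix-empty column (a ρ ∸ b (suc ρ)) (a ρ) (m∸n≤m (a ρ) (b (suc ρ)))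
                       (λ c lo hi → column-empty ρ c (subst (_≤ c) a∸[a∸b']≡b' lo) hi))
                    (cong (λ z → concatMap column (downFrom z)) a∸[a∸b']≡b') ⟩
        concatMap column (downFrom (b (suc ρ)))
      ≡⟨ concatMap-columns t (suc ρ) (trans (cong b (+-suc t ρ)) h) ⟩
        stripBoxesFrom b a (suc ρ) t
      ∎

  stripBoxes≡ : stripBoxes α β ≡ stripBoxesFrom b a 0 (length β)
  stripBoxes≡ = concatMap-columns (length β) 0 (length≤⇒part≡0 β (length β + 0) (m≤m+n _ 0))

jstep-strip : ∀ K (X : ShapeSeq) (α β : Partition) e (s : JState) N →
  IsHStripSeq X → (∀ m q → N ≤ q → X m q ≡ 0) → (∀ q → X 0 q ≡ part β q) → IsHStrip (part α) (part β) →
  (∀ q → part β (suc q) ≤ part β q) → Represents K X s →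
  Outcome K (ruleColumn (part α) X) s (foldl jstep s (withEntry e (stripBoxes α β))) (λ r t → keepIf (e ≤ᵇ t) (X K r ∸ ruleColumn (part α) X K r))
jstep-strip K X α β e s N X-strips X-short X₀≡β α⊆β β-parts rep =
  subst (λ bs → Outcome K (ruleColumn a X) s (foldl jstep s (withEntry e bs)) (λ r t → keepIf (e ≤ᵇ t) (X K r ∸ ruleColumn a X K r)))
        (sym boxes≡)
        (Represents-cong K (foldl jstep s (withEntry e (cornerBoxes (X 0) ρs))) SS.afterSlides≡ruleColumn (proj₁ slides) ,
         (λ r t → trans (proj₂ slides r t) (cong (λ z → keepIf (e ≤ᵇ t) z + vacatedCount r t (vacated s)) (SS.occurrences-column K r))))
  where
  a b : Shape
  a = part α
  b = part β
  ρs : List ℕ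
  ρs = stripRows (λ q → b q ∸ a q) 0 (length β)
  boxes≡ : stripBoxes α β ≡ cornerBoxes (X 0) ρs
  boxes≡ = trans (StripBoxes.stripBoxes≡ α β β-parts α⊆β) (sym (cornerBoxes-stripRows b a (length β) 0 (X 0) (λ q _ → X₀≡β q)))
  slides : Outcome K (afterSlides X ρs) s (foldl jstep s (withEntry e (cornerBoxes (X 0) ρs))) (λ r t → keepIf (e ≤ᵇ t) (occurrences r (slidePaths X ρs K)))
  slides = jstep-slides K e ρs X s rep (AreCorners-stripRows b a α⊆β (length β) 0 (X 0) (λ q _ → X₀≡β q))
  α⊆X₀ : IsHStrip a (X 0)
  α⊆X₀ q = subst (a q ≤_) (sym (X₀≡β q)) (proj₁ (α⊆β q)) , subst (_≤ a q) (sym (X₀≡β (suc q))) (proj₂ (α⊆β q))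
  n₀ : Shape
  n₀ q = X 0 q ∸ a q
  ρs≡ : ρs ≡ stripRows n₀ 0 N
  ρs≡ = trans (stripRows-cong (λ q → cong (_∸ a q) (sym (X₀≡β q))) 0 (length β))
         (trans (sym (stripRows-pad n₀ (length β) N (λ q q≥ → trans (cong (_∸ a q) (trans (X₀≡β q) (length≤⇒part≡0 β q q≥))) (0∸n≡0 (a q)))))
           (trans (cong (stripRows n₀ 0) (+-comm (length β) N))
             (stripRows-pad n₀ N (length β) (λ q q≥ → trans (cong (_∸ a q) (X-short 0 q q≥)) (0∸n≡0 (a q))))))
  module SS = StripSlides X a N ρs X-strips α⊆X₀ X-short ρs≡

-- The tableaux met during the jeu de taquin

clamp : (k j : ℕ) → Fin (suc k)
clamp zero j = fzero
clamp (suc k) zero = fzero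
clamp (suc k) (suc j) = fsuc (clamp k j)

clamp-toℕ : ∀ k (x : Fin (suc k)) → clamp k (toℕ x) ≡ x
clamp-toℕ zero fzero = refl
clamp-toℕ (suc k) fzero = refl
clamp-toℕ (suc k) (fsuc x) = cong fsuc (clamp-toℕ k x)

clamp-≡ : ∀ k (x : Fin (suc k)) j → toℕ x ≡ j → clamp k j ≡ x
clamp-≡ k x j e = trans (cong (clamp k) (sym e)) (clamp-toℕ k x)

toℕ-clamp : ∀ k j → j ≤ k → toℕ (clamp k j) ≡ j
toℕ-clamp zero zero _ = refl
toℕ-clamp (suc k) zero _ = refl
toℕ-clamp (suc k) (suc j) (s≤s j≤k) = cong suc (toℕ-clamp k j j≤k)

clamp-zero : ∀ k → clamp k 0 ≡ fzero
clamp-zero zero = refl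
clamp-zero (suc k) = refl

clamp-beyond : ∀ k j → k ≤ j → clamp k j ≡ fromℕ k
clamp-beyond zero j _ = refl
clamp-beyond (suc k) (suc j) (s≤s k≤j) = cong fsuc (clamp-beyond k j k≤j)

clamp-inject₁ : ∀ {k j} (j<k : j < k) → clamp k j ≡ inject₁ (fromℕ< j<k)
clamp-inject₁ {k} {j} j<k = clamp-≡ k (inject₁ (fromℕ< j<k)) j (trans (toℕ-inject₁ (fromℕ< j<k)) (toℕ-fromℕ< j<k))

clamp-suc : ∀ {k j} (j<k : j < k) → clamp k (suc j) ≡ fsuc (fromℕ< j<k)
clamp-suc {k} {j} j<k = clamp-≡ k (fsuc (fromℕ< j<k)) (suc j) (cong suc (toℕ-fromℕ< j<k))

IsHStripSeq-cong : ∀ {C C'} → (∀ m q → C m q ≡ C' m q) → IsHStripSeq C → IsHStripSeq C'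
IsHStripSeq-cong e C-strips m q = subst₂ _≤_ (e m q) (e (suc m) q) (proj₁ (C-strips m q)) , subst₂ _≤_ (e (suc m) (suc q)) (e m q) (proj₂ (C-strips m q))

k∸j≡suc[k∸suc[j]] : ∀ k j → j < k → k ∸ j ≡ suc (k ∸ suc j)
k∸j≡suc[k∸suc[j]] (suc k) zero _ = refl
k∸j≡suc[k∸suc[j]] (suc k) (suc j) (s≤s j<k) = k∸j≡suc[k∸suc[j]] k j j<k

module Shapes (k K : ℕ) (P : Chain k) (Q : Chain K) (P-tableau : IsTableau P) (Q-tableau : IsTableau Q) (Q₀≐Pₖ : Q fzero ≐ P (fromℕ k)) where

  Pℕ : ℕ → Shape
  Pℕ j = part (P (clamp k j))

  Qℕ : ShapeSeq
  Qℕ m = part (Q (clamp K m))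

  δ : Partition
  δ = outerB Q

  N : ℕ
  N = length δ

  Qℕ-beyond : ∀ m q → K ≤ m → Qℕ m q ≡ part δ q
  Qℕ-beyond m q K≤m = cong (λ z → part (Q z) q) (clamp-beyond K m K≤m)

  δ-parts : ∀ q → part δ (suc q) ≤ part δ q
  δ-parts = proj₁ Q-tableau (fromℕ K)

  Qℕ-parts : ∀ m q → Qℕ m (suc q) ≤ Qℕ m q
  Qℕ-parts m = proj₁ Q-tableau (clamp K m)

  Qℕ-strips : IsHStripSeq Qℕ
  Qℕ-strips m q with suc m ≤? K
  ... | yes m<K = subst₂ (λ a b → IsHStrip (part (Q a)) (part (Q b))) (sym (clamp-inject₁ m<K)) (sym (clamp-suc m<K))
                         (proj₂ Q-tableau (fromℕ< m<K)) q
  ... | no m≮K = subst₂ _≤_ (sym (Qℕ-beyond m q K≤m)) (sym (Qℕ-beyond (suc m) q (≤-trans K≤m (n≤1+n m)))) ≤-refl ,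
                 subst₂ _≤_ (sym (Qℕ-beyond (suc m) (suc q) (≤-trans K≤m (n≤1+n m)))) (sym (Qℕ-beyond m q K≤m)) (δ-parts q)
    where
    K≤m : K ≤ m
    K≤m = ≤-pred (≰⇒> m≮K)

  Pℕ-strips : ∀ j → j < k → IsHStrip (Pℕ j) (Pℕ (suc j))
  Pℕ-strips j j<k = subst₂ (λ a b → IsHStrip (part (P a)) (part (P b))) (sym (clamp-inject₁ j<k)) (sym (clamp-suc j<k)) (proj₂ P-tableau (fromℕ< j<k))

  Qℕ-mono : ∀ r i j → i ≤ j → j ≤ K → Qℕ i r ≤ Qℕ j r
  Qℕ-mono r = seq-mono (λ i → Qℕ i r) K (λ j _ → proj₁ (Qℕ-strips j r))

  Qℕ≤δ : ∀ m q → Qℕ m q ≤ part δ q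
  Qℕ≤δ m q with m ≤? K
  ... | yes m≤K = subst (Qℕ m q ≤_) (Qℕ-beyond K q ≤-refl) (Qℕ-mono q m K m≤K ≤-refl)
  ... | no m≰K = ≤-reflexive (Qℕ-beyond m q (<⇒≤ (≰⇒> m≰K)))

  -- X j is the tableau obtained from Q by sliding into the strips of P
  -- with entries k, k − 1, …, j + 1.
  Xafter : ℕ → ShapeSeq
  Xafter zero = Qℕ
  Xafter (suc d) = ruleColumn (Pℕ (k ∸ suc d)) (Xafter d)

  X : ℕ → ShapeSeq
  X j = Xafter (k ∸ j)

  X-ruleColumn : ∀ j → j < k → ∀ m q → X j m q ≡ ruleColumn (Pℕ j) (X (suc j)) m q
  X-ruleColumn j j<k m q = trans (cong (λ z → Xafter z m q) e) (cong (λ z → ruleColumn (Pℕ z) (Xafter (k ∸ suc j)) m q) e')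
    where
    e : k ∸ j ≡ suc (k ∸ suc j)
    e = k∸j≡suc[k∸suc[j]] k j j<k
    e' : k ∸ suc (k ∸ suc j) ≡ j
    e' = trans (cong (k ∸_) (sym e)) (m∸[m∸n]≡n (<⇒≤ j<k))

  X-top : ∀ m q → X k m q ≡ Qℕ m q
  X-top m q = cong (λ z → Xafter z m q) (n∸n≡0 k)

  XFacts : ℕ → Set
  XFacts j = IsHStripSeq (X j) × (∀ q → X j 0 q ≡ Pℕ j q) × (∀ m q → X j m q ≤ Qℕ m q)

  short-below-Q : ∀ (C : ShapeSeq) → (∀ m q → C m q ≤ Qℕ m q) → ∀ m q → N ≤ q → C m q ≡ 0
  short-below-Q C C≤Q m q N≤q = n≤0⇒n≡0 (≤-trans (C≤Q m q) (≤-trans (Qℕ≤δ m q) (≤-reflexive (length≤⇒part≡0 δ q N≤q))))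

  Pℕ⊆X : ∀ j → j < k → XFacts (suc j) → IsHStrip (Pℕ j) (X (suc j) 0)
  Pℕ⊆X j j<k facts q = subst (Pℕ j q ≤_) (sym (proj₁ (proj₂ facts) q)) (proj₁ (Pℕ-strips j j<k q)) ,
                       subst (_≤ Pℕ j q) (sym (proj₁ (proj₂ facts) (suc q))) (proj₂ (Pℕ-strips j j<k q))

  module StripOf (j : ℕ) (j<k : j < k) (facts : XFacts (suc j)) =
    StripSlides (X (suc j)) (Pℕ j) N (stripRows (λ q → X (suc j) 0 q ∸ Pℕ j q) 0 N) (proj₁ facts) (Pℕ⊆X j j<k facts)
                (short-below-Q (X (suc j)) (proj₂ (proj₂ facts))) refl

  X-facts-from : ∀ d j → d + j ≡ k → XFacts j
  X-facts-from zero j e =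
    IsHStripSeq-cong (λ m q → sym (trans (cong (λ z → X z m q) e) (X-top m q))) Qℕ-strips ,
    (λ q → trans (cong (λ z → X z 0 q) e)
           (trans (X-top 0 q) (trans (cong (λ z → part (Q z) q) (clamp-zero K))
           (trans (Q₀≐Pₖ q) (cong (λ z → part (P z) q) (sym (clamp-beyond k j (≤-reflexive (sym e))))))))) ,
    (λ m q → ≤-reflexive (trans (cong (λ z → X z m q) e) (X-top m q)))
  X-facts-from (suc d) j e =
    IsHStripSeq-cong (λ m q → sym (X-ruleColumn j j<k m q)) S.ruleColumn-isHStripSeq ,
    (λ q → X-ruleColumn j j<k 0 q) ,
    (λ m q → ≤-trans (≤-reflexive (X-ruleColumn j j<k m q)) (≤-trans (proj₁ (proj₁ (S.column m) q)) (proj₂ (proj₂ IH) m q)))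
    where
    IH : XFacts (suc j)
    IH = X-facts-from d (suc j) (trans (+-suc d j) e)
    j<k : j < k
    j<k = subst (j <_) e (s≤s (m≤n+m j d))
    module S = StripOf j j<k IH

  X-facts : ∀ j → j ≤ k → XFacts j
  X-facts j j≤k = X-facts-from (k ∸ j) j (m∸n+n≡m j≤k)

  ruleColumn-⊆ : ∀ j → j < k → ∀ m → IsHStrip (ruleColumn (Pℕ j) (X (suc j)) m) (X (suc j) m)
  ruleColumn-⊆ j j<k m = proj₁ (StripOf.column j j<k (X-facts (suc j) j<k) m)

  X-mono : ∀ j → j < k → ∀ m q → X j m q ≤ X (suc j) m q
  X-mono j j<k m q = ≤-trans (≤-reflexive (X-ruleColumn j j<k m q)) (proj₁ (ruleColumn-⊆ j j<k m q))

  X-short : ∀ j → j ≤ k → ∀ m q → N ≤ q → X j m q ≡ 0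
  X-short j j≤k = short-below-Q (X j) (proj₂ (proj₂ (X-facts j j≤k)))

foldl-concatMap : ∀ {A B S : Set} (f : S → B → S) (g : A → List B) s xs → foldl f s (concatMap g xs) ≡ foldl (λ s x → foldl f s (g x)) s xs
foldl-concatMap f g s [] = refl
foldl-concatMap f g s (x ∷ xs) = trans (foldl-++ f s (g x) _) (foldl-concatMap f g (foldl f s (g x)) xs)

foldr-tabulate-induction : ∀ {S : Set} k (F : Fin k → S → S) (I : ℕ → S → Set) → (∀ x s → I (suc (toℕ x)) s → I (toℕ x) (F x s)) →
  ∀ n o (f : Fin n → Fin k) → (∀ i → toℕ (f i) ≡ o + toℕ i) → o + n ≡ k → ∀ s → I k s → I o (foldr F s (tabulate f))
foldr-tabulate-induction k F I step zero o f f≡ e s Is = subst (λ z → I z s) (sym (trans (sym (+-identityʳ o)) e)) Is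
foldr-tabulate-induction k F I step (suc n) o f f≡ e s Is =
  subst (λ z → I z (F (f fzero) (foldr F s (tabulate (λ i → f (fsuc i)))))) f₀≡o
    (step (f fzero) _ (subst (λ z → I (suc z) (foldr F s (tabulate (λ i → f (fsuc i))))) (sym f₀≡o) IH))
  where
  f₀≡o : toℕ (f fzero) ≡ o
  f₀≡o = trans (f≡ fzero) (+-identityʳ o)
  IH : I (suc o) (foldr F s (tabulate (λ i → f (fsuc i))))
  IH = foldr-tabulate-induction k F I step n (suc o) (λ i → f (fsuc i)) (λ i → trans (f≡ (fsuc i)) (+-suc o (toℕ i))) (trans (sym (+-suc o n)) e) s Is

count-tabulate : ∀ {A : Set} n (f : Fin n → A) (p : A → Bool) m → (∀ j → p (f j) ≡ (toℕ j <ᵇ m)) → length (filterᵇ p (tabulate f)) ≡ m ⊓ n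
count-tabulate zero f p m h = sym (⊓-zeroʳ m)
count-tabulate (suc n) f p zero h rewrite h fzero = count-tabulate n (λ i → f (fsuc i)) p zero (λ j → h (fsuc j))
count-tabulate (suc n) f p (suc m) h rewrite h fzero = cong suc (count-tabulate n (λ i → f (fsuc i)) p m (λ j → h (fsuc j)))

[n∸m+o]+m≡o+n : ∀ {m n} o → m ≤ n → ((n ∸ m) + o) + m ≡ o + n
[n∸m+o]+m≡o+n {m} {n} o m≤n = begin
    ((n ∸ m) + o) + m ≡⟨ cong (_+ m) (+-comm (n ∸ m) o) ⟩
    (o + (n ∸ m)) + m ≡⟨ +-assoc o (n ∸ m) m ⟩
    o + ((n ∸ m) + m) ≡⟨ cong (o +_) (m∸n+n≡m m≤n) ⟩
    o + n             ∎
  where open ≡-Reasoning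

module Loop (k K : ℕ) (P : Chain k) (Q : Chain K) (P-tableau : IsTableau P) (Q-tableau : IsTableau Q) (Q₀≐Pₖ : Q fzero ≐ P (fromℕ k)) where
  open Shapes k K P Q P-tableau Q-tableau Q₀≐Pₖ public

  VacatedInvariant : ℕ → List (ℕ × ℕ × ℕ) → Set
  VacatedInvariant j vac = ∀ r t → vacatedCount r t vac + X j K r ≡ X (j ⊔ (t ⊓ k)) K r

  LoopInvariant : ℕ → JState → Set
  LoopInvariant j s = Represents K (X j) s × VacatedInvariant j (vacated s)

  stripOfP : Fin k → List ((ℕ × ℕ) × ℕ)
  stripOfP x = withEntry (suc (toℕ x)) (stripBoxes (P (inject₁ x)) (P (fsuc x)))

  vacatedInvariant-step : ∀ j → j < k → ∀ vac vac' → VacatedInvariant (suc j) vac →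
    (∀ r t → vacatedCount r t vac' ≡ keepIf (suc j ≤ᵇ t) (X (suc j) K r ∸ X j K r) + vacatedCount r t vac) →
    VacatedInvariant j vac'
  vacatedInvariant-step j j<k vac vac' inv counts r t with suc j ≤? t
  ... | yes j<t = begin
      vacatedCount r t vac' + X j K r                 ≡⟨ cong (_+ X j K r) (trans (counts r t) (cong (λ z → keepIf z (X (suc j) K r ∸ X j K r) + v) (≤ᵇ-true j<t))) ⟩
      ((X (suc j) K r ∸ X j K r) + v) + X j K r       ≡⟨ [n∸m+o]+m≡o+n v (X-mono j j<k K r) ⟩
      v + X (suc j) K r                               ≡⟨ inv r t ⟩
      X (suc j ⊔ (t ⊓ k)) K r                         ≡⟨ cong (λ z → X z K r) (trans (m≤n⇒m⊔n≡n j<t⊓k) (sym (m≤n⇒m⊔n≡n (≤-trans (n≤1+n j) j<t⊓k)))) ⟩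
      X (j ⊔ (t ⊓ k)) K r                             ∎
    where
    open ≡-Reasoning
    v : ℕ
    v = vacatedCount r t vac
    j<t⊓k : suc j ≤ t ⊓ k
    j<t⊓k = ⊓-glb j<t j<k
  ... | no j≮t = begin
      vacatedCount r t vac' + X j K r                 ≡⟨ cong (_+ X j K r) (trans (counts r t) (cong (λ z → keepIf z (X (suc j) K r ∸ X j K r) + v) (≤ᵇ-false j≮t))) ⟩
      v + X j K r                                     ≡⟨ cong (_+ X j K r) v≡0 ⟩
      X j K r                                         ≡⟨ cong (λ z → X z K r) (sym (m≥n⇒m⊔n≡m t⊓k≤j)) ⟩
      X (j ⊔ (t ⊓ k)) K r                             ∎
    where
    open ≡-Reasoning
    v : ℕ
    v = vacatedCount r t vac
    t⊓k≤j : t ⊓ k ≤ j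
    t⊓k≤j = ≤-trans (m⊓n≤m t k) (≤-pred (≰⇒> j≮t))
    v≡0 : v ≡ 0
    v≡0 = +-cancelʳ-≡ (X (suc j) K r) v 0 (trans (inv r t) (cong (λ z → X z K r) (m≥n⇒m⊔n≡m (≤-trans t⊓k≤j (n≤1+n j)))))

  loopInvariant-step : ∀ (x : Fin k) s → LoopInvariant (suc (toℕ x)) s → LoopInvariant (toℕ x) (foldl jstep s (stripOfP x))
  loopInvariant-step x s (rep , inv) =
    Represents-cong K (foldl jstep s (stripOfP x)) ruleColumn≡X (proj₁ strip) ,
    vacatedInvariant-step j j<k (vacated s) (vacated (foldl jstep s (stripOfP x))) inv
      (λ r t → trans (proj₂ strip r t) (cong (λ z → keepIf (suc j ≤ᵇ t) (X (suc j) K r ∸ z) + vacatedCount r t (vacated s)) (ruleColumn≡X K r)))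
    where
    j : ℕ
    j = toℕ x
    j<k : j < k
    j<k = toℕ<n x
    facts : XFacts (suc j)
    facts = X-facts (suc j) j<k
    X₀≡ : ∀ q → X (suc j) 0 q ≡ part (P (fsuc x)) q
    X₀≡ q = trans (proj₁ (proj₂ facts) q) (cong (λ z → part (P z) q) (clamp-≡ k (fsuc x) (suc j) refl))
    strip : Outcome K (ruleColumn (part (P (inject₁ x))) (X (suc j))) s (foldl jstep s (stripOfP x))
                    (λ r t → keepIf (suc j ≤ᵇ t) (X (suc j) K r ∸ ruleColumn (part (P (inject₁ x))) (X (suc j)) K r))
    strip = jstep-strip K (X (suc j)) (P (inject₁ x)) (P (fsuc x)) (suc j) s N (proj₁ facts) (short-below-Q _ (proj₂ (proj₂ facts))) X₀≡
              (proj₂ P-tableau x) (proj₁ P-tableau (fsuc x)) rep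
    ruleColumn≡X : ∀ m q → ruleColumn (part (P (inject₁ x))) (X (suc j)) m q ≡ X j m q
    ruleColumn≡X m q = trans (ruleColumn-cong (X (suc j)) (λ q → cong (λ z → part (P z) q) (sym (clamp-≡ k (inject₁ x) j (toℕ-inject₁ x)))) m q)
                              (sym (X-ruleColumn j j<k m q))

  fillingOf-fills : Fills K Qℕ (fillingOf Q)
  fillingOf-fills m r c m<K lower upper =
    cong suc (trans (count-tabulate K (λ i → i) (λ j → part (Q (fsuc j)) r ≤ᵇ c) m below) (m≤n⇒m⊓n≡m (<⇒≤ m<K)))
    where
    Q-suc : ∀ (j : Fin K) → part (Q (fsuc j)) r ≡ Qℕ (suc (toℕ j)) r
    Q-suc j = cong (λ z → part (Q z) r) (sym (clamp-≡ K (fsuc j) (suc (toℕ j)) refl))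
    below : ∀ j → (part (Q (fsuc j)) r ≤ᵇ c) ≡ (toℕ j <ᵇ m)
    below j with toℕ j <? m
    ... | yes j<m = trans (≤ᵇ-true (subst (_≤ c) (sym (Q-suc j)) (≤-trans (Qℕ-mono r (suc (toℕ j)) m j<m (<⇒≤ m<K)) lower))) (sym (<ᵇ-true j<m))
    ... | no j≮m = trans (≤ᵇ-false (λ z → <-irrefl refl (<-≤-trans upper (≤-trans (Qℕ-mono r (suc m) (suc (toℕ j)) (s≤s (≮⇒≥ j≮m)) (toℕ<n j))
                        (subst (_≤ c) (Q-suc j) z))))) (sym (<ᵇ-false j≮m))

  start : JState
  start = fillingOf Q , outerB Q , []

  loopInvariant-start : LoopInvariant k start
  loopInvariant-start =
    Represents-cong K start (λ m q → sym (X-top m q))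
      (fillingOf-fills , (λ r → sym (Qℕ-beyond K r ≤-refl)) , (λ m _ q → Qℕ-parts m q) , (λ m _ → Qℕ-strips m)) ,
    (λ r t → cong (λ z → X z K r) (sym (m≥n⇒m⊔n≡m (m⊓n≤n t k))))

  final : JState
  final = foldl jstep start (boxesP P)

  loopInvariant-final : LoopInvariant 0 final
  loopInvariant-final =
    subst (LoopInvariant 0) (sym (trans (foldl-concatMap jstep stripOfP start (reverse (allFin k)))
                                        (reverse-foldl (λ s x → foldl jstep s (stripOfP x)) start (allFin k))))
      (foldr-tabulate-induction k (λ x s → foldl jstep s (stripOfP x)) LoopInvariant loopInvariant-step k 0 (λ i → i) (λ i → refl) refl start loopInvariant-start)

-- Reading off T and U

part-map-applyUpTo : ∀ (h : ℕ → ℕ) L (f : ℕ → ℕ) r → r < L → part (map h (applyUpTo f L)) r ≡ h (f r)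
part-map-applyUpTo h (suc L) f zero _ = refl
part-map-applyUpTo h (suc L) f (suc r) (s≤s r<L) = part-map-applyUpTo h L (λ i → f (suc i)) r r<L

part-map-applyUpTo-beyond : ∀ (h : ℕ → ℕ) L (f : ℕ → ℕ) r → L ≤ r → part (map h (applyUpTo f L)) r ≡ 0
part-map-applyUpTo-beyond h zero f r _ = refl
part-map-applyUpTo-beyond h (suc L) f (suc r) (s≤s L≤r) = part-map-applyUpTo-beyond h L (λ i → f (suc i)) r L≤r

applyUpTo-+ : ∀ (f : ℕ → ℕ) m n → applyUpTo f (m + n) ≡ applyUpTo f m ++ applyUpTo (λ i → f (m + i)) n
applyUpTo-+ f zero n = refl
applyUpTo-+ f (suc m) n = cong (f 0 ∷_) (applyUpTo-+ (λ i → f (suc i)) m n)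

countᵇ-++ : ∀ (p : ℕ → Bool) xs ys → countᵇ p (xs ++ ys) ≡ countᵇ p xs + countᵇ p ys
countᵇ-++ p xs ys = trans (cong length (filter-++ _ xs ys)) (length-++ (filterᵇ p xs))

countᵇ-all : ∀ (p : ℕ → Bool) n (f : ℕ → ℕ) → (∀ i → i < n → p (f i) ≡ true) → countᵇ p (applyUpTo f n) ≡ n
countᵇ-all p zero f h = refl
countᵇ-all p (suc n) f h rewrite h 0 (s≤s z≤n) = cong suc (countᵇ-all p n (λ i → f (suc i)) (λ i i<n → h (suc i) (s≤s i<n)))

countᵇ-none : ∀ (p : ℕ → Bool) n (f : ℕ → ℕ) → (∀ i → i < n → p (f i) ≡ false) → countᵇ p (applyUpTo f n) ≡ 0
countᵇ-none p n f h = cong length (filterᵇ-none p n f h)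

countᵇ-interval : ∀ (p : ℕ → Bool) L a b → a ≤ b → b ≤ L → (∀ c → c < a → p c ≡ false) → (∀ c → a ≤ c → c < b → p c ≡ true) →
                  (∀ c → b ≤ c → c < L → p c ≡ false) → countᵇ p (upTo L) ≡ b ∸ a
countᵇ-interval p L a b a≤b b≤L before inside after = begin
    countᵇ p (upTo L)
  ≡⟨ cong (λ z → countᵇ p (upTo z)) (sym L≡) ⟩
    countᵇ p (applyUpTo (λ i → i) (a + ((b ∸ a) + (L ∸ b))))
  ≡⟨ cong (countᵇ p) (applyUpTo-+ (λ i → i) a _) ⟩
    countᵇ p (applyUpTo (λ i → i) a ++ applyUpTo (λ i → a + i) ((b ∸ a) + (L ∸ b)))
  ≡⟨ countᵇ-++ p (applyUpTo (λ i → i) a) _ ⟩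
    countᵇ p (applyUpTo (λ i → i) a) + countᵇ p (applyUpTo (λ i → a + i) ((b ∸ a) + (L ∸ b)))
  ≡⟨ cong₂ _+_ (countᵇ-none p a (λ i → i) before) (cong (countᵇ p) (applyUpTo-+ (λ i → a + i) (b ∸ a) (L ∸ b))) ⟩
    countᵇ p (applyUpTo (λ i → a + i) (b ∸ a) ++ applyUpTo (λ i → a + ((b ∸ a) + i)) (L ∸ b))
  ≡⟨ countᵇ-++ p (applyUpTo (λ i → a + i) (b ∸ a)) _ ⟩
    countᵇ p (applyUpTo (λ i → a + i) (b ∸ a)) + countᵇ p (applyUpTo (λ i → a + ((b ∸ a) + i)) (L ∸ b))
  ≡⟨ cong₂ _+_ (countᵇ-all p (b ∸ a) (λ i → a + i) (λ i i< → inside (a + i) (m≤m+n a i) (subst (a + i <_) (m+[n∸m]≡n a≤b) (+-monoʳ-< a i<))))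
               (countᵇ-none p (L ∸ b) (λ i → a + ((b ∸ a) + i))
                  (λ i i< → after _ (subst (_≤ a + ((b ∸ a) + i)) (m+[n∸m]≡n a≤b) (+-monoʳ-≤ a (m≤m+n (b ∸ a) i)))
                                    (subst (a + ((b ∸ a) + i) <_) L≡ (+-monoʳ-< a (+-monoʳ-< (b ∸ a) i<))))) ⟩
    (b ∸ a) + 0
  ≡⟨ +-identityʳ _ ⟩
    b ∸ a
  ∎
  where
  open ≡-Reasoning
  L≡ : a + ((b ∸ a) + (L ∸ b)) ≡ L
  L≡ = trans (sym (+-assoc a (b ∸ a) (L ∸ b))) (trans (cong (_+ (L ∸ b)) (m+[n∸m]≡n a≤b)) (m+[n∸m]≡n b≤L))

module Result (k K : ℕ) (P : Chain k) (Q : Chain K) (P-tableau : IsTableau P) (Q-tableau : IsTableau Q) (Q₀≐Pₖ : Q fzero ≐ P (fromℕ k)) where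
  open Loop k K P Q P-tableau Q-tableau Q₀≐Pₖ public

  f : Filling
  f = proj₁ final
  ε : Partition
  ε = proj₁ (proj₂ final)
  rep : Represents K (X 0) final
  rep = proj₁ loopInvariant-final
  inv : VacatedInvariant 0 (vacated final)
  inv = proj₂ loopInvariant-final
  facts₀ : XFacts 0
  facts₀ = X-facts 0 z≤n

  inner≡ : ∀ r → part (P fzero) r ≡ X 0 0 r
  inner≡ r = sym (trans (proj₁ (proj₂ facts₀) r) (cong (λ z → part (P z) r) (clamp-zero k)))

  ε≡ : ∀ r → part ε r ≡ X 0 K r
  ε≡ = proj₁ (proj₂ rep)

  T-shapes : ∀ (j : Fin (suc k)) r → part (proj₁ (jdt P Q) j) r ≡ X (toℕ j) K r
  T-shapes j r with r <? N
  ... | yes r<N = trans (part-map-applyUpTo (λ r → part ε r + vacatedCount r (toℕ j) (vacated final)) N (λ i → i) r r<N)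
                   (trans (cong (_+ vacatedCount r (toℕ j) (vacated final)) (ε≡ r))
                     (trans (+-comm (X 0 K r) _) (trans (inv r (toℕ j)) (cong (λ z → X z K r) (m≤n⇒m⊓n≡m (≤-pred (toℕ<n j)))))))
  ... | no r≮N = trans (part-map-applyUpTo-beyond (λ r → part ε r + vacatedCount r (toℕ j) (vacated final)) N (λ i → i) r (≮⇒≥ r≮N))
                  (sym (X-short (toℕ j) (≤-pred (toℕ<n j)) K r (≮⇒≥ r≮N)))

  X₀-mono : ∀ r i j → i ≤ j → j ≤ K → X 0 i r ≤ X 0 j r
  X₀-mono r = seq-mono (λ i → X 0 i r) K (λ j _ → proj₁ (proj₁ facts₀ j r))

  U-row-count : ∀ j → j ≤ K → ∀ r → countᵇ (λ c → (part (P fzero) r ≤ᵇ c) ∧ (f r c ≤ᵇ j)) (upTo (part ε r)) ≡ X 0 j r ∸ X 0 0 r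
  U-row-count j j≤K r =
    trans (countᵇ-interval counted (part ε r) (part (P fzero) r) (X 0 j r) (subst (_≤ X 0 j r) (sym (inner≡ r)) (X₀-mono r 0 j z≤n j≤K))
                           (subst (X 0 j r ≤_) (sym (ε≡ r)) (X₀-mono r j K j≤K ≤-refl)) before inside after)
          (cong (X 0 j r ∸_) (inner≡ r))
    where
    counted : ℕ → Bool
    counted c = (part (P fzero) r ≤ᵇ c) ∧ (f r c ≤ᵇ j)
    entry : ∀ c → X 0 0 r ≤ c → c < X 0 K r → Σ ℕ (λ m → m < K × X 0 m r ≤ c × c < X 0 (suc m) r × f r c ≡ suc m)
    entry c lower upper with seq-crossing (λ i → X 0 i r) c K 0 z≤n lower upper
    ... | (m , _ , m<K , lower' , upper') = m , m<K , lower' , upper' , proj₁ rep m r c m<K lower' upper'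
    before : ∀ c → c < part (P fzero) r → counted c ≡ false
    before c c<α rewrite ≤ᵇ-false (<⇒≱ c<α) = refl
    inside : ∀ c → part (P fzero) r ≤ c → c < X 0 j r → counted c ≡ true
    inside c α≤c c<X with entry c (subst (_≤ c) (inner≡ r) α≤c) (<-≤-trans c<X (X₀-mono r j K j≤K ≤-refl))
    ... | (m , m<K , lower , _ , fm) rewrite ≤ᵇ-true α≤c | fm = ≤ᵇ-true m<j
      where
      m<j : suc m ≤ j
      m<j with suc m ≤? j
      ... | yes m<j = m<j
      ... | no m≮j = ⊥-elim (<-irrefl refl (<-≤-trans c<X (≤-trans (X₀-mono r j m (≤-pred (≰⇒> m≮j)) (<⇒≤ m<K)) lower)))
    after : ∀ c → X 0 j r ≤ c → c < part ε r → counted c ≡ false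
    after c X≤c c<ε with entry c (≤-trans (X₀-mono r 0 j z≤n j≤K) X≤c) (subst (c <_) (ε≡ r) c<ε)
    ... | (m , _ , _ , upper , fm) rewrite ≤ᵇ-true (subst (_≤ c) (sym (inner≡ r)) (≤-trans (X₀-mono r 0 j z≤n j≤K) X≤c)) | fm = ≤ᵇ-false m≮j
      where
      m≮j : ¬ (suc m ≤ j)
      m≮j m<j = <-irrefl refl (<-≤-trans upper (≤-trans (X₀-mono r (suc m) j m<j j≤K) X≤c))

  U-shapes : ∀ (j : Fin (suc K)) r → part (proj₂ (jdt P Q) j) r ≡ X 0 (toℕ j) r
  U-shapes j r with r <? N
  ... | yes r<N =
    trans (part-map-applyUpTo (λ r → part (P fzero) r + countᵇ (λ c → (part (P fzero) r ≤ᵇ c) ∧ (f r c ≤ᵇ toℕ j)) (upTo (part ε r))) N (λ i → i) r r<N)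
          (trans (cong₂ _+_ (inner≡ r) (U-row-count (toℕ j) j≤K r)) (m+[n∸m]≡n (X₀-mono r 0 (toℕ j) z≤n j≤K)))
    where
    j≤K : toℕ j ≤ K
    j≤K = ≤-pred (toℕ<n j)
  ... | no r≮N = trans (part-map-applyUpTo-beyond _ N (λ i → i) r (≮⇒≥ r≮N)) (sym (X-short 0 z≤n (toℕ j) r (≮⇒≥ r≮N)))

-- The growth diagram

prependℕ : ℕ → ℕ → Shape → Shape
prependℕ i l g p = if p <ᵇ i then l else g (p ∸ i)

part-prepend : ∀ i l λs p → part (prepend i l λs) p ≡ prependℕ i l (part λs) p
part-prepend zero l λs p = refl
part-prepend (suc i) l λs zero = refl
part-prepend (suc i) l λs (suc p) = part-prepend i l λs p

prependℕ-top : ∀ i l g p → p < i → prependℕ i l g p ≡ l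
prependℕ-top i l g p p<i rewrite <ᵇ-true p<i = refl

prependℕ-below : ∀ i l g p → i ≤ p → prependℕ i l g p ≡ g (p ∸ i)
prependℕ-below i l g p i≤p rewrite <ᵇ-false (≤⇒≯ i≤p) = refl

prependℕ-cong : ∀ i l {g g'} → (∀ q → g q ≡ g' q) → ∀ p → prependℕ i l g p ≡ prependℕ i l g' p
prependℕ-cong i l e p with p <ᵇ i
... | true = refl
... | false = e (p ∸ i)

prependℕ-prependℕ : ∀ a b l g p → prependℕ a l (prependℕ b l g) p ≡ prependℕ (a + b) l g p
prependℕ-prependℕ a b l g p with p <? a
... | yes p<a = trans (prependℕ-top a l (prependℕ b l g) p p<a) (sym (prependℕ-top (a + b) l g p (≤-trans p<a (m≤m+n a b))))
... | no p≮a with (p ∸ a) <? b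
...   | yes p∸a<b = trans (prependℕ-below a l (prependℕ b l g) p (≮⇒≥ p≮a)) (trans (prependℕ-top b l g (p ∸ a) p∸a<b)
                      (sym (prependℕ-top (a + b) l g p (subst (_< a + b) (m+[n∸m]≡n (≮⇒≥ p≮a)) (+-monoʳ-< a p∸a<b)))))
...   | no p∸a≮b = trans (prependℕ-below a l (prependℕ b l g) p (≮⇒≥ p≮a)) (trans (prependℕ-below b l g (p ∸ a) (≮⇒≥ p∸a≮b))
                      (trans (cong g (∸-+-assoc p a b)) (sym (prependℕ-below (a + b) l g p
                        (subst (a + b ≤_) (m+[n∸m]≡n (≮⇒≥ p≮a)) (+-monoʳ-≤ a (≮⇒≥ p∸a≮b)))))))

prependℕ-≤ : ∀ i l g p → (∀ q → g q ≤ l) → prependℕ i l g p ≤ l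
prependℕ-≤ i l g p g≤l with p <ᵇ i
... | true = ≤-refl
... | false = g≤l (p ∸ i)

-- The local rule without truncated subtraction.
LocalRule⇒α+δ≡ : ∀ l α β γ δ → LocalRule l α β γ δ → (∀ p → part α p ≤ part β p) → (∀ p → part α p ≤ part γ p) →
  ∀ p → part α p + part δ (suc p) ≡ (part β (suc p) ⊔ part γ (suc p)) + (part β p ⊓ part γ p)
LocalRule⇒α+δ≡ l α β γ δ rule α≤β α≤γ p =
  trans (cong (part α p +_) (rule (suc (suc p)))) (m+[n∸m]≡n (≤-trans (⊓-glb (α≤β p) (α≤γ p)) (m≤n+m _ _)))

module Growth (k K : ℕ) (P : Chain k) (Q : Chain K) (P-tableau : IsTableau P) (Q-tableau : IsTableau Q) (Q₀≐Pₖ : Q fzero ≐ P (fromℕ k))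
              (l : ℕ) (δ₀≤l : part (outerB Q) 0 ≤ l) (Gr : Array K k) (growth : IsGrowthDiagram l Gr)
              (lastRow : ∀ j → Gr (fromℕ K) j ≐ shiftT K l P j) (lastColumn : ∀ i → Gr i (fromℕ k) ≐ complement K l Q i) where
  open Result k K P Q P-tableau Q-tableau Q₀≐Pₖ public

  G : ℕ → ℕ → Partition
  G i j = Gr (clamp K i) (clamp k j)

  -- The entry in row i and column j of the growth diagram built from the
  -- jeu de taquin.
  expected : ℕ → ℕ → Shape
  expected i j = prependℕ i l (X j (K ∸ i))

  X≤l : ∀ j → j ≤ k → ∀ m q → X j m q ≤ l
  X≤l j j≤k m q = ≤-trans (proj₂ (proj₂ (X-facts j j≤k)) m q) (≤-trans (Qℕ≤δ m q) (≤-trans (seq-antitone (part δ) δ-parts 0 q z≤n) δ₀≤l))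

  G-localRule : ∀ i j → i < K → j < k → LocalRule l (G i j) (G i (suc j)) (G (suc i) j) (G (suc i) (suc j))
  G-localRule i j i<K j<k rewrite clamp-inject₁ i<K | clamp-suc i<K | clamp-inject₁ j<k | clamp-suc j<k =
    proj₂ (proj₂ (proj₂ (proj₂ growth))) (fromℕ< i<K) (fromℕ< j<k)

  G-row-⊆ : ∀ i j → j < k → ∀ p → part (G i j) p ≤ part (G i (suc j)) p
  G-row-⊆ i j j<k p rewrite clamp-inject₁ j<k | clamp-suc j<k = proj₁ (proj₂ (proj₁ growth (clamp K i)) (fromℕ< j<k) p)

  G-column-⊆ : ∀ i j → i < K → ∀ p → part (G i j) p ≤ part (G (suc i) j) p
  G-column-⊆ i j i<K p rewrite clamp-inject₁ i<K | clamp-suc i<K = proj₁ (proj₂ (proj₁ (proj₂ growth) (clamp k j)) (fromℕ< i<K) p)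

  -- Z stands for the q-th part of (l, X j m).
  X-rule-additive : ∀ j → j < k → ∀ m q Z → (q ≡ 0 → Z ≡ l) → (∀ q' → q ≡ suc q' → Z ≡ X j m q') →
    X j (suc m) q + X (suc j) m q ≡ (X (suc j) (suc m) (suc q) ⊔ X j m q) + (X (suc j) (suc m) q ⊓ Z)
  X-rule-additive j j<k m q Z Z-top Z-below = begin
      X j (suc m) q + C m q
    ≡⟨ cong (_+ C m q) (X-ruleColumn j j<k (suc m) q) ⟩
      (((C (suc m) (suc q) ⊔ Γ q) + ruleMin (C (suc m)) Γ q) ∸ C m q) + C m q
    ≡⟨ m∸n+n≡m (≤-trans (L.D≤ruleMin q) (m≤n+m _ _)) ⟩
      (C (suc m) (suc q) ⊔ Γ q) + ruleMin (C (suc m)) Γ q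
    ≡⟨ cong₂ (λ x y → (C (suc m) (suc q) ⊔ x) + y) (sym (X-ruleColumn j j<k m q)) (ruleMin≡ q Z-top Z-below) ⟩
      (C (suc m) (suc q) ⊔ X j m q) + (C (suc m) q ⊓ Z)
    ∎
    where
    open ≡-Reasoning
    C : ShapeSeq
    C = X (suc j)
    Γ : Shape
    Γ = ruleColumn (Pℕ j) C m
    module L = StripLevel (C m) (C (suc m)) Γ (ruleColumn-⊆ j j<k m) (proj₁ (X-facts (suc j) j<k) m)
    ruleMin≡ : ∀ q → (q ≡ 0 → Z ≡ l) → (∀ q' → q ≡ suc q' → Z ≡ X j m q') → ruleMin (C (suc m)) Γ q ≡ C (suc m) q ⊓ Z
    ruleMin≡ zero Z-top _ = sym (trans (cong (C (suc m) 0 ⊓_) (Z-top refl)) (m≤n⇒m⊓n≡m (X≤l (suc j) j<k (suc m) 0)))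
    ruleMin≡ (suc q') _ Z-below = cong (C (suc m) (suc q') ⊓_) (sym (trans (Z-below q' refl) (X-ruleColumn j j<k m q')))

  expected-rule-additive : ∀ i j → i < K → j < k → ∀ p →
    expected i j p + expected (suc i) (suc j) (suc p)
      ≡ (expected i (suc j) (suc p) ⊔ expected (suc i) j (suc p)) + (expected i (suc j) p ⊓ expected (suc i) j p)
  expected-rule-additive i j i<K j<k p =
    subst (λ z → prependℕ i l (X j z) p + prependℕ i l (X (suc j) m) p
                   ≡ (prependℕ i l (X (suc j) z) (suc p) ⊔ prependℕ i l (X j m) p) + (prependℕ i l (X (suc j) z) p ⊓ prependℕ (suc i) l (X j m) p))
          (sym K∸i≡) unshifted
    where
    m : ℕ
    m = K ∸ suc i
    K∸i≡ : K ∸ i ≡ suc m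
    K∸i≡ = k∸j≡suc[k∸suc[j]] K i i<K
    unshifted : prependℕ i l (X j (suc m)) p + prependℕ i l (X (suc j) m) p
              ≡ (prependℕ i l (X (suc j) (suc m)) (suc p) ⊔ prependℕ i l (X j m) p) + (prependℕ i l (X (suc j) (suc m)) p ⊓ prependℕ (suc i) l (X j m) p)
    unshifted with p <? i
    ... | yes p<i rewrite prependℕ-top i l (X j (suc m)) p p<i | prependℕ-top i l (X (suc j) m) p p<i | prependℕ-top i l (X j m) p p<i
                        | prependℕ-top i l (X (suc j) (suc m)) p p<i | prependℕ-top (suc i) l (X j m) p (≤-trans p<i (n≤1+n i))
                        | m≤n⇒m⊔n≡n (prependℕ-≤ i l (X (suc j) (suc m)) (suc p) (X≤l (suc j) j<k (suc m))) | ⊓-idem l = refl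
    ... | no p≮i rewrite prependℕ-below i l (X j (suc m)) p (≮⇒≥ p≮i) | prependℕ-below i l (X (suc j) m) p (≮⇒≥ p≮i)
                       | prependℕ-below i l (X j m) p (≮⇒≥ p≮i) | prependℕ-below i l (X (suc j) (suc m)) p (≮⇒≥ p≮i)
                       | prependℕ-below i l (X (suc j) (suc m)) (suc p) (≤-trans (≮⇒≥ p≮i) (n≤1+n p))
                       | +-∸-assoc 1 (≮⇒≥ p≮i)
      = X-rule-additive j j<k m (p ∸ i) (prependℕ (suc i) l (X j m) p) Z-top Z-below
      where
      Z-top : p ∸ i ≡ 0 → prependℕ (suc i) l (X j m) p ≡ l
      Z-top e = prependℕ-top (suc i) l (X j m) p (s≤s (m∸n≡0⇒m≤n e))
      Z-below : ∀ q' → p ∸ i ≡ suc q' → prependℕ (suc i) l (X j m) p ≡ X j m q'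
      Z-below q' e = trans (prependℕ-below (suc i) l (X j m) p i<p) (cong (X j m) (suc-injective (trans (sym (+-∸-assoc 1 i<p)) e)))
        where
        i<p : suc i ≤ p
        i<p with suc i ≤? p
        ... | yes i<p = i<p
        ... | no i≮p = ⊥-elim (1+n≢0 (trans (sym e) (m≤n⇒m∸n≡0 (≤-pred (≰⇒> i≮p)))))

  G-lastRow : ∀ j → j ≤ k → ∀ p → part (G K j) p ≡ expected K j p
  G-lastRow j j≤k p = begin
      part (Gr (clamp K K) (clamp k j)) p ≡⟨ cong (λ z → part (Gr z (clamp k j)) p) (clamp-beyond K K ≤-refl) ⟩
      part (Gr (fromℕ K) (clamp k j)) p   ≡⟨ lastRow (clamp k j) p ⟩
      part (shiftT K l P (clamp k j)) p   ≡⟨ part-prepend K l (P (clamp k j)) p ⟩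
      prependℕ K l (Pℕ j) p               ≡⟨ prependℕ-cong K l (λ q → trans (sym (proj₁ (proj₂ (X-facts j j≤k)) q)) (cong (λ z → X j z q) (sym (n∸n≡0 K)))) p ⟩
      expected K j p                      ∎
    where open ≡-Reasoning

  G-lastColumn : ∀ i → i ≤ K → ∀ p → part (G i k) p ≡ expected i k p
  G-lastColumn i i≤K p = begin
      part (Gr (clamp K i) (clamp k k)) p                 ≡⟨ cong (λ z → part (Gr (clamp K i) z) p) (clamp-beyond k k ≤-refl) ⟩
      part (Gr (clamp K i) (fromℕ k)) p                   ≡⟨ lastColumn (clamp K i) p ⟩
      part (complement K l Q (clamp K i)) p               ≡⟨ part-prepend (toℕ (clamp K i)) l (Q (opposite (clamp K i))) p ⟩
      prependℕ (toℕ (clamp K i)) l (part (Q (opposite (clamp K i)))) p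
        ≡⟨ cong (λ z → prependℕ z l (part (Q (opposite (clamp K i)))) p) (toℕ-clamp K i i≤K) ⟩
      prependℕ i l (part (Q (opposite (clamp K i)))) p    ≡⟨ prependℕ-cong i l (λ q → trans (cong (λ z → part (Q z) q) (sym opposite≡)) (sym (X-top (K ∸ i) q))) p ⟩
      expected i k p                                      ∎
    where
    open ≡-Reasoning
    opposite≡ : clamp K (K ∸ i) ≡ opposite (clamp K i)
    opposite≡ = clamp-≡ K (opposite (clamp K i)) (K ∸ i) (trans (opposite-prop (clamp K i)) (cong (K ∸_) (toℕ-clamp K i i≤K)))

  -- The local rule determines the upper left corner of each square from
  -- the other three: induction from the last row and column.
  G≡expected-from : ∀ a b i j → i + a ≡ K → j + b ≡ k → ∀ p → part (G i j) p ≡ expected i j p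
  G≡expected-from zero b i j i≡K j+b≡k p =
    subst (λ z → part (G z j) p ≡ expected z j p) (sym (trans (sym (+-identityʳ i)) i≡K)) (G-lastRow j (subst (j ≤_) j+b≡k (m≤m+n j b)) p)
  G≡expected-from (suc a) zero i j i+a≡K j≡k p =
    subst (λ z → part (G i z) p ≡ expected i z p) (sym (trans (sym (+-identityʳ j)) j≡k)) (G-lastColumn i (subst (i ≤_) i+a≡K (m≤m+n i (suc a))) p)
  G≡expected-from (suc a) (suc b) i j i+a≡K j+b≡k p =
    +-cancelʳ-≡ (expected (suc i) (suc j) (suc p)) (part (G i j) p) (expected i j p) (begin
      part (G i j) p + expected (suc i) (suc j) (suc p)
        ≡⟨ cong (part (G i j) p +_) (sym (below-right (suc p))) ⟩
      part (G i j) p + part (G (suc i) (suc j)) (suc p)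
        ≡⟨ LocalRule⇒α+δ≡ l (G i j) (G i (suc j)) (G (suc i) j) (G (suc i) (suc j)) (G-localRule i j i<K j<k) (G-row-⊆ i j j<k) (G-column-⊆ i j i<K) p ⟩
      (part (G i (suc j)) (suc p) ⊔ part (G (suc i) j) (suc p)) + (part (G i (suc j)) p ⊓ part (G (suc i) j) p)
        ≡⟨ cong₂ _+_ (cong₂ _⊔_ (right (suc p)) (below (suc p))) (cong₂ _⊓_ (right p) (below p)) ⟩
      (expected i (suc j) (suc p) ⊔ expected (suc i) j (suc p)) + (expected i (suc j) p ⊓ expected (suc i) j p)
        ≡⟨ expected-rule-additive i j i<K j<k p ⟨
      expected i j p + expected (suc i) (suc j) (suc p) ∎)
    where
    open ≡-Reasoning
    i+1+a≡K : suc i + a ≡ K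
    i+1+a≡K = trans (sym (+-suc i a)) i+a≡K
    j+1+b≡k : suc j + b ≡ k
    j+1+b≡k = trans (sym (+-suc j b)) j+b≡k
    i<K : i < K
    i<K = subst (i <_) i+a≡K (m<m+n i (s≤s z≤n))
    j<k : j < k
    j<k = subst (j <_) j+b≡k (m<m+n j (s≤s z≤n))
    below : ∀ p → part (G (suc i) j) p ≡ expected (suc i) j p
    below = G≡expected-from a (suc b) (suc i) j i+1+a≡K j+b≡k
    right : ∀ p → part (G i (suc j)) p ≡ expected i (suc j) p
    right = G≡expected-from (suc a) b i (suc j) i+a≡K j+1+b≡k
    below-right : ∀ p → part (G (suc i) (suc j)) p ≡ expected (suc i) (suc j) p
    below-right = G≡expected-from a b (suc i) (suc j) i+1+a≡K j+1+b≡k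

  G≡expected : ∀ (i : Fin (suc K)) (j : Fin (suc k)) p → part (Gr i j) p ≡ expected (toℕ i) (toℕ j) p
  G≡expected i j p = trans (cong₂ (λ x y → part (Gr x y) p) (sym (clamp-toℕ K i)) (sym (clamp-toℕ k j)))
                           (G≡expected-from (K ∸ toℕ i) (k ∸ toℕ j) (toℕ i) (toℕ j) (m+[n∸m]≡n (≤-pred (toℕ<n i))) (m+[n∸m]≡n (≤-pred (toℕ<n j))) p)

  T≈firstRow : ∀ (T' : Chain k) → (∀ j → Gr fzero j ≐ T' j) → proj₁ (jdt P Q) ≈T shiftT 0 0 T'
  T≈firstRow T' firstRow j p = trans (T-shapes j p) (sym (trans (sym (firstRow j p)) (G≡expected fzero j p)))

  complement-firstColumn≈U : ∀ (U' : Chain K) → (∀ i → Gr i fzero ≐ U' i) → complement K l U' ≈T shiftT K l (proj₂ (jdt P Q))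
  complement-firstColumn≈U U' firstColumn i p = begin
      part (complement K l U' i) p
    ≡⟨ part-prepend (toℕ i) l (U' (opposite i)) p ⟩
      prependℕ (toℕ i) l (part (U' (opposite i))) p
    ≡⟨ prependℕ-cong (toℕ i) l U'≡ p ⟩
      prependℕ (toℕ i) l (prependℕ (K ∸ toℕ i) l (X 0 (toℕ i))) p
    ≡⟨ prependℕ-prependℕ (toℕ i) (K ∸ toℕ i) l (X 0 (toℕ i)) p ⟩
      prependℕ (toℕ i + (K ∸ toℕ i)) l (X 0 (toℕ i)) p
    ≡⟨ cong (λ z → prependℕ z l (X 0 (toℕ i)) p) (m+[n∸m]≡n i≤K) ⟩
      prependℕ K l (X 0 (toℕ i)) p
    ≡⟨ prependℕ-cong K l (λ q → sym (U-shapes i q)) p ⟩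
      prependℕ K l (part (proj₂ (jdt P Q) i)) p
    ≡⟨ part-prepend K l (proj₂ (jdt P Q) i) p ⟨
      part (shiftT K l (proj₂ (jdt P Q)) i) p
    ∎
    where
    open ≡-Reasoning
    i≤K : toℕ i ≤ K
    i≤K = ≤-pred (toℕ<n i)
    U'≡ : ∀ q → part (U' (opposite i)) q ≡ prependℕ (K ∸ toℕ i) l (X 0 (toℕ i)) q
    U'≡ q = begin
      part (U' (opposite i)) q                                  ≡⟨ firstColumn (opposite i) q ⟨
      part (Gr (opposite i) fzero) q                            ≡⟨ G≡expected (opposite i) fzero q ⟩
      prependℕ (toℕ (opposite i)) l (X 0 (K ∸ toℕ (opposite i))) q ≡⟨ cong (λ z → prependℕ z l (X 0 (K ∸ z)) q) (opposite-prop i) ⟩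
      prependℕ (K ∸ toℕ i) l (X 0 (K ∸ (K ∸ toℕ i))) q          ≡⟨ prependℕ-cong (K ∸ toℕ i) l (λ q' → cong (λ z → X 0 z q') (m∸[m∸n]≡n i≤K)) q ⟩
      prependℕ (K ∸ toℕ i) l (X 0 (toℕ i)) q                    ∎

theorem4p2 : ∀ {k k' : ℕ} (l : ℕ) (P : Chain k) (Q : Chain k') →
    IsTableau P → IsTableau Q →
    Q fzero ≐ P (fromℕ k) →
    part (outerB Q) 0 ≤ l →
    ∀ (T' : Chain k) (U' : Chain k') →
    InternalInsertion l (shiftT k' l P) (complement k' l Q) T' U' →
    ShiftEq (proj₁ (jdt P Q)) T' × ShiftEq (proj₂ (jdt P Q)) (complement k' l U')
theorem4p2 {k} {k'} l P Q P-tableau Q-tableau Q₀≐Pₖ δ₀≤l T' U' (G , growth , lastRow , lastColumn , firstRow , firstColumn) =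
  inj₁ (0 , 0 , T≈firstRow T' firstRow) , inj₂ (l , k' , complement-firstColumn≈U U' firstColumn)
  where open Growth k k' P Q P-tableau Q-tableau Q₀≐Pₖ l δ₀≤l G growth lastRow lastColumn
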